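{- For every integer $n\geq 2$, the number of spanning quasi-trees of the bouquet $\mathbb{F}'_n$ equals the $(n-1)$-th Lucas number: $\kappa(\mathbb{F}'_n)=\ell_{n-1}$.
   Context: A ribbon graph is a surface with boundary made of vertex discs and edge ribbons; each edge ribbon meets vertex discs in exactly two disjoint arcs, each lying on the boundary of exactly one vertex and one edge. A bouquet is a ribbon graph with exactly one vertex, so all edges are loops; a loop is non-orientable if together with the vertex it forms a Möbius band, and orientable otherwise. For $F\subseteq E(G)$, the spanning ribbon subgraph $(V(G),F)$ is obtained by deleting the edges outside $F$. A quasi-tree is a ribbon graph with exactly one boundary component, and $\kappa(G)$ is the number of sets $F\subseteq E(G)$ such that $(V(G),F)$ is a quasi-tree. A bouquet with edges $1,\dots,n$ is described by a signed rotation: a cyclic sequence in which each label $i$ occurs twice, recording the order in which the two ends of the edges meet the boundary of the vertex; an occurrence may carry a minus sign (a plus sign is omitted), and edge $i$ is an orientable loop iff its two occurrences have the same sign. The bouquet $\mathbb{F}'_2$ has signed rotation $(1,2,2,1)$; for $n\geq 3$, $\mathbb{F}'_n$ has signed rotation consisting of $1,2,3,2,1$, followed by $i,i-1$ for $i=4,\dots,n$, followed by $n$, i.e. $(1,2,3,2,1,4,3,5,4,\dots,n,n-1,n)$ (all loops orientable). Lucas numbers: $\ell_1=1$, $\ell_2=3$, $\ell_k=\ell_{k-1}+\ell_{k-2}$. -}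

module Defs where

open import Data.Nat using (ℕ; zero; suc; _+_; _*_; _∸_; _≤_; _<ᵇ_; _≡ᵇ_; _%_)
open import Data.Bool using (Bool; true; false; if_then_else_; _∧_; not; _xor_)
open import Data.List using (List; []; _∷_; _++_; length; filter; map; concat; upTo; foldr; lookup)
open import Data.Product using (_×_; _,_; proj₁; proj₂)
open import Data.Vec using (Vec; []; _∷_)
import Data.Vec as Vec
open import Data.Fin using (Fin)
open import Relation.Nullary.Decidable using (does)
open import Data.Nat using (_≤?_)

-- A bouquet with edges 1,…,n is given by its signed rotation: a list
-- (read cyclically) of occurrences (label , minus?) where label ∈ {1..n}
-- and the Bool is true iff the occurrence carries a minus sign.

Occ : Set
Occ = ℕ × Bool

SignedRotation : Set
SignedRotation = List Occ

-- A set F ⊆ E = {1,…,n} of edges is a subset of Fin n: edge (suc (toℕ i))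
-- belongs to F iff the i-th entry is true.
EdgeSet : ℕ → Set
EdgeSet n = Vec Bool n

inF : ∀ {n} → EdgeSet n → ℕ → Bool
inF []       _             = false
inF (b ∷ bs) zero          = false
inF (b ∷ bs) (suc zero)    = b
inF (b ∷ bs) (suc (suc k)) = inF bs (suc k)

allEdgeSets : (n : ℕ) → List (EdgeSet n)
allEdgeSets zero    = [] ∷ []
allEdgeSets (suc n) = map (false ∷_) (allEdgeSets n) ++ map (true ∷_) (allEdgeSets n)

-- signed rotation of the spanning ribbon subgraph (V(G), F):
-- delete the occurrences of edges outside F.
restrict : ∀ {n} → EdgeSet n → SignedRotation → SignedRotation
restrict F w = filter (λ o → Data.Bool.T? (inF F (proj₁ o))) w

-- Boundary of the ribbon graph of a bouquet with signed rotation w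
-- (list of m occurrences, positions p = 0..m-1 around the vertex disc).
-- The attaching arc of the edge-end at position p has two endpoints on the
-- vertex boundary: L_p (encoded 2p) and R_p (encoded 2p+1), in the cyclic
-- order of the vertex boundary.  The boundary of the surface consists of
--  * vertex-boundary arcs ("corners") joining R_p to L_{p+1 mod m};
--  * the two sides of each edge ribbon: for an edge with ends at positions
--    p ≠ q, if the loop is orientable (same signs) the sides join L_p–R_q and
--    R_p–L_q; if it is non-orientable (different signs, i.e. a half twist)
--    they join L_p–L_q and R_p–R_q.
-- These 2m points with the two perfect matchings form a disjoint union of
-- cycles, one per boundary component.

private
  occAt : SignedRotation → ℕ → Occ
  occAt []       _       = (0 , false)
  occAt (o ∷ os) zero    = o
  occAt (o ∷ os) (suc k) = occAt os k

  -- position of the other occurrence of the label at position p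
  -- (returns p itself if there is none)
  partnerFrom : SignedRotation → ℕ → ℕ → ℕ → ℕ
  partnerFrom []       lab p i = p
  partnerFrom (o ∷ os) lab p i =
    if (proj₁ o ≡ᵇ lab) ∧ not (i ≡ᵇ p) then i else partnerFrom os lab p (suc i)

  half : ℕ → ℕ
  half zero          = zero
  half (suc zero)    = zero
  half (suc (suc k)) = suc (half k)

  isOdd : ℕ → Bool
  isOdd zero          = false
  isOdd (suc zero)    = true
  isOdd (suc (suc k)) = isOdd k

corner : ℕ → ℕ → ℕ
corner m x with isOdd x
... | true  = 2 * ((suc (half x)) % suc (m ∸ 1))
... | false = suc (2 * ((half x + (m ∸ 1)) % suc (m ∸ 1)))

ribbon : SignedRotation → ℕ → ℕ
ribbon w x =
  let p     = half x
      o     = occAt w p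
      q     = partnerFrom w (proj₁ o) p 0
      twist = proj₂ o xor proj₂ (occAt w q)
      side  = if twist then isOdd x else not (isOdd x)
  in if side then suc (2 * q) else 2 * q

-- the boundary walk from endpoint x, alternating corner and ribbon
-- (k rounds of corner-then-ribbon); with k = 2m it covers the whole
-- boundary component of x
walk : SignedRotation → ℕ → ℕ → List ℕ
walk w zero    x = x ∷ []
walk w (suc k) x = x ∷ corner (length w) x ∷ walk w k (ribbon w (corner (length w) x))

private
  allB : List Bool → Bool
  allB = foldr _∧_ true

  count : ∀ {A : Set} → (A → Bool) → List A → ℕ
  count P []       = 0
  count P (a ∷ as) = if P a then suc (count P as) else count P as

isLeast : SignedRotation → ℕ → Bool
isLeast w x = allB (map (λ y → does (x ≤? y)) (walk w (2 * length w) x))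

-- number of boundary components of the bouquet with signed rotation w
-- (a bouquet with no edges is a disc: one boundary component)
boundaryComponents : SignedRotation → ℕ
boundaryComponents [] = 1
boundaryComponents w@(_ ∷ _) = count (isLeast w) (upTo (2 * length w))

isQuasiTree : SignedRotation → Bool
isQuasiTree w = boundaryComponents w ≡ᵇ 1

κ : (n : ℕ) → SignedRotation → ℕ
κ n w = count (λ F → isQuasiTree (restrict F w)) (allEdgeSets n)

lucas : ℕ → ℕ
lucas zero                = 2
lucas (suc zero)          = 1
lucas (suc (suc k))       = lucas (suc k) + lucas k

-- The bouquet F'_n (all occurrences with plus sign).
-- F'_2 = (1,2,2,1);  for n ≥ 3:
-- (1,2,3,2,1, 4,3, 5,4, …, n,n-1, n)
private
  plus : ℕ → Occ
  plus i = (i , false)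

  middle : ℕ → List Occ
  middle n = concat (map (λ j → plus (j + 4) ∷ plus (j + 3) ∷ []) (upTo (n ∸ 3)))

F′ : ℕ → SignedRotation
F′ (suc (suc zero)) = plus 1 ∷ plus 2 ∷ plus 2 ∷ plus 1 ∷ []
F′ n = (plus 1 ∷ plus 2 ∷ plus 3 ∷ plus 2 ∷ plus 1 ∷ []) ++ middle n ++ (plus n ∷ [])

module Submission where

open import Data.Bool using (Bool; true; false; T; not; _∧_; _xor_; if_then_else_)
open import Data.Bool.ListAction using (all)
open import Data.Bool.Properties using (T-≡; ¬-not; ⇔→≡)
open import Data.Empty using (⊥-elim)
open import Data.Fin using (toℕ; fromℕ<)
import Data.Fin.Properties as Fin
open import Data.List using (List; []; _∷_; length; _++_; map; concat; upTo; applyUpTo)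
open import Data.List.Membership.Propositional using (_∈_)
open import Data.List.Membership.Propositional.Properties
  using (∈-applyUpTo⁺; ∈-applyUpTo⁻; ∈-map⁺; ∈-++⁺ˡ; ∈-++⁺ʳ)
open import Data.List.Properties using (length-++; ++-assoc; map-++; concat-++; upTo-∷ʳ; filter-++)
open import Data.List.Relation.Unary.All as All using (All; []; _∷_)
import Data.List.Relation.Unary.All.Properties as Allₚ
open import Data.List.Relation.Unary.Any using (here; there)
open import Data.Nat using (ℕ; zero; suc; _+_; _*_; _∸_; _%_; _<_; _≤_; z≤n; s≤s; pred; _≡ᵇ_; _<?_; _≤?_)
open import Data.Nat.DivMod using (m<n⇒m%n≡m; n%n≡0; [m+n]%n≡m%n; m%n<n)
open import Data.Nat.Induction using (<-rec)
open import Data.Nat.Properties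
open import Algebra.Properties.CommutativeSemigroup +-commutativeSemigroup using (interchange)
open import Data.Product using (_×_; _,_; proj₁; proj₂; ∃-syntax)
open import Data.Sum using (_⊎_; inj₁; inj₂)
open import Data.Vec using ([]; _∷_; _∷ʳ_; initLast)
open import Function using (_∘_)
open import Function.Bundles using (_⇔_; mk⇔; Equivalence)
import Function.Properties.Equivalence as ⇔
open import Level using (0ℓ)
open import Relation.Binary.Core using (Rel; _=[_]⇒_)
open import Relation.Binary.Construct.Closure.Equivalence using (EqClosure; gfold; isEquivalence; symmetric)
open import Relation.Binary.Construct.Closure.ReflexiveTransitive using (ε; _◅_; _◅◅_)
open import Relation.Binary.Construct.Closure.Symmetric using (SymClosure; fwd; bwd)
open import Relation.Binary.Construct.Union using (_∪_)
open import Relation.Binary.Definitions using (tri<; tri≈; tri>)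
open import Relation.Binary.PropositionalEquality
  using (_≡_; _≢_; refl; sym; trans; cong; cong₂; subst; module ≡-Reasoning)
open import Relation.Nullary using (Dec; yes; no; does)
open import Relation.Nullary.Decidable using (True; toWitness; dec-true; dec-false; _×-dec_)

open import Defs

-- A bouquet with all loops orientable and partner map π (π p is the position of the other end
-- of the loop at position p) has as boundary components the orbits of the face permutation
-- τ = π ∘ (p ↦ p + 1 mod m) on its m positions, so it is a quasi-tree iff the graph of τ is
-- connected.  Split the spanning subgraphs of F′ₙ₊₂ (n ≥ 3) by the edges n+1 and n+2.  Without
-- n+2 they are the spanning subgraphs of F′ₙ₊₁.  With n+2 but without n+1, the two ends of n+2
-- are adjacent, τ fixes one of them, and there are at least two faces.  With both, the signed
-- rotation is P (n+1) Q (n+2) (n+1) (n+2) where P Q is a spanning subgraph of F′ₙ, and the four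
-- new ends only subdivide two faces of P Q, so it is a quasi-tree iff P Q is one.  Hence
-- κ(F′ₙ₊₂) = κ(F′ₙ₊₁) + κ(F′ₙ), starting from κ(F′₃) = 3 and κ(F′₄) = 4, which are evaluated.
-- The same case split shows that π stays an involution on every spanning subgraph of F′ₙ.

-- Counting

count : ∀ {A : Set} → (A → Bool) → List A → ℕ
count P [] = 0
count P (x ∷ xs) = if P x then suc (count P xs) else count P xs

count-unique : ∀ {A : Set} (P : A → Bool) (C : List A → ℕ) → C [] ≡ 0 →
               (∀ x xs → C (x ∷ xs) ≡ (if P x then suc (C xs) else C xs)) →
               ∀ xs → C xs ≡ count P xs
count-unique P C C[] C∷ [] = C[]
count-unique P C C[] C∷ (x ∷ xs) with P x | C∷ x xs
... | true  | eq = trans eq (cong suc (count-unique P C C[] C∷ xs))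
... | false | eq = trans eq (count-unique P C C[] C∷ xs)

module _ {A : Set} (P : A → Bool) where

  count≡0⇒ : ∀ {xs x} → count P xs ≡ 0 → x ∈ xs → P x ≡ false
  count≡0⇒ {y ∷ xs} eq x∈ with P y in Py
  count≡0⇒ {y ∷ xs} eq (here refl) | false = Py
  count≡0⇒ {y ∷ xs} eq (there x∈) | false = count≡0⇒ eq x∈

  count≡0⇐ : ∀ {xs} → (∀ {x} → x ∈ xs → P x ≡ false) → count P xs ≡ 0
  count≡0⇐ {[]}     _     = refl
  count≡0⇐ {x ∷ xs} none rewrite none (here refl) = count≡0⇐ (none ∘ there)

count-++ : ∀ {A : Set} (P : A → Bool) xs ys → count P (xs ++ ys) ≡ count P xs + count P ys
count-++ P []       ys = refl
count-++ P (x ∷ xs) ys with P x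
... | true  = cong suc (count-++ P xs ys)
... | false = count-++ P xs ys

count-map : ∀ {A B : Set} (P : B → Bool) (f : A → B) xs → count P (map f xs) ≡ count (P ∘ f) xs
count-map P f []       = refl
count-map P f (x ∷ xs) with P (f x)
... | true  = cong suc (count-map P f xs)
... | false = count-map P f xs

count-cong : ∀ {A : Set} {P R : A → Bool} → (∀ x → P x ≡ R x) → ∀ xs → count P xs ≡ count R xs
count-cong P≗R []       = refl
count-cong {R = R} P≗R (x ∷ xs) rewrite P≗R x with R x
... | true  = cong suc (count-cong P≗R xs)
... | false = count-cong P≗R xs

module _ {A : Set} (p : A → Bool) where

  all-false⇒ : ∀ xs → all p xs ≡ false → ∃[ y ] y ∈ xs × p y ≡ false
  all-false⇒ (x ∷ xs) eq with p x in px
  ... | true  with y , y∈ , py ← all-false⇒ xs eq = y , there y∈ , py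
  ... | false = x , here refl , px

  all-false⇐ : ∀ {xs y} → y ∈ xs → p y ≡ false → all p xs ≡ false
  all-false⇐ {x ∷ xs} (here refl) py rewrite py = refl
  all-false⇐ {x ∷ xs} (there y∈) py with p x
  ... | true  = all-false⇐ y∈ py
  ... | false = refl

≤?-false⇔> : ∀ {x y} → does (x ≤? y) ≡ false ⇔ y < x
≤?-false⇔> {x} {y} =
  mk⇔ (λ eq → ≰⇒> (λ x≤y → subst T eq (≤⇒≤ᵇ x≤y))) (λ y<x → dec-false (x ≤? y) (<⇒≱ y<x))

-- Connectivity of graphs on {0, …, N - 1}

Edge : ℕ → (ℕ → ℕ) → Rel ℕ 0ℓ
Edge N f x y = x < N × f x ≡ y

Connected : ℕ → Rel ℕ 0ℓ → Set
Connected N E = ∀ {x} → x < N → EqClosure E x 0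

≡⇒EqClosure : ∀ {E : Rel ℕ 0ℓ} {x y} → x ≡ y → EqClosure E x y
≡⇒EqClosure refl = ε

connected-onto : ∀ {M N} {E F : Rel ℕ 0ℓ} (f : ℕ → ℕ) → E =[ f ]⇒ EqClosure F →
                 (∀ {y} → y < N → ∃[ x ] x < M × EqClosure F y (f x)) →
                 Connected M E → Connected N F
connected-onto {F = F} f f-edge onto conn y<N with onto y<N | onto (≤-trans (s≤s z≤n) y<N)
... | x , x<M , y~fx | x₀ , x₀<M , 0~fx₀ =
  y~fx ◅◅ lift (conn x<M) ◅◅ symmetric F (lift (conn x₀<M)) ◅◅ symmetric F 0~fx₀
  where lift = gfold (isEquivalence F) f f-edge

module _ {N : ℕ} {f : ℕ → ℕ} (f-injective : ∀ {a b} → a < N → b < N → f a ≡ f b → a ≡ b)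
         {x : ℕ} (x<N : x < N) (fx≡x : f x ≡ x) where

  fixed-point-isolated : ∀ {z y} → z ≡ x → EqClosure (Edge N f) z y → y ≡ x
  fixed-point-isolated z≡x ε = z≡x
  fixed-point-isolated refl (fwd (_ , refl) ◅ p) = fixed-point-isolated fx≡x p
  fixed-point-isolated refl (bwd (z<N , fz≡x) ◅ p) =
    fixed-point-isolated (f-injective z<N x<N (trans fz≡x (sym fx≡x))) p

module InvolutionWalk (N : ℕ) (c r : ℕ → ℕ)
  (c< : ∀ {x} → x < N → c x < N) (c-involutive : ∀ {x} → x < N → c (c x) ≡ x)
  (r< : ∀ {x} → x < N → r x < N) (r-involutive : ∀ {x} → x < N → r (r x) ≡ x) where

  Step : Rel ℕ 0ℓ
  Step = Edge N c ∪ Edge N r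

  σ : ℕ → ℕ
  σ x = r (c x)

  alternatingWalk : ℕ → ℕ → List ℕ
  alternatingWalk zero    x = x ∷ []
  alternatingWalk (suc k) x = x ∷ c x ∷ alternatingWalk k (σ x)

  step-c : ∀ {x} → x < N → EqClosure Step x (c x)
  step-c x<N = fwd (inj₁ (x<N , refl)) ◅ ε

  step-σ : ∀ {x} → x < N → EqClosure Step x (σ x)
  step-σ x<N = step-c x<N ◅◅ fwd (inj₂ (c< x<N , refl)) ◅ ε

  walk-sound : ∀ k {x y} → x < N → y ∈ alternatingWalk k x → EqClosure Step x y
  walk-sound zero    x<N (here refl)         = ε
  walk-sound (suc k) x<N (here refl)         = ε
  walk-sound (suc k) x<N (there (here refl)) = step-c x<N
  walk-sound (suc k) x<N (there (there y∈))  = step-σ x<N ◅◅ walk-sound k (r< (c< x<N)) y∈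

  σ^ : ℕ → ℕ → ℕ
  σ^ zero    x = x
  σ^ (suc i) x = σ (σ^ i x)

  σ^< : ∀ i {x} → x < N → σ^ i x < N
  σ^< zero    x<N = x<N
  σ^< (suc i) x<N = r< (c< (σ^< i x<N))

  σ^-+ : ∀ i j x → σ^ (i + j) x ≡ σ^ i (σ^ j x)
  σ^-+ zero    j x = refl
  σ^-+ (suc i) j x = cong σ (σ^-+ i j x)

  σ^-suc : ∀ i x → σ^ (suc i) x ≡ σ^ i (σ x)
  σ^-suc i x = trans (cong (λ k → σ^ k x) (+-comm 1 i)) (σ^-+ i 1 x)

  σ-injective : ∀ {x y} → x < N → y < N → σ x ≡ σ y → x ≡ y
  σ-injective {x} {y} x<N y<N σx≡σy = begin
    x             ≡⟨ c-involutive x<N ⟨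
    c (c x)       ≡⟨ cong c (r-involutive (c< x<N)) ⟨
    c (r (σ x))   ≡⟨ cong (λ z → c (r z)) σx≡σy ⟩
    c (r (σ y))   ≡⟨ cong c (r-involutive (c< y<N)) ⟩
    c (c y)       ≡⟨ c-involutive y<N ⟩
    y             ∎
    where open ≡-Reasoning

  σ^-injective : ∀ i {x y} → x < N → y < N → σ^ i x ≡ σ^ i y → x ≡ y
  σ^-injective zero    _   _   eq = eq
  σ^-injective (suc i) x<N y<N eq = σ^-injective i x<N y<N (σ-injective (σ^< i x<N) (σ^< i y<N) eq)

  period : ∀ {x} → x < N → ∃[ p ] 0 < p × p ≤ N × σ^ p x ≡ x
  period {x} x<N with Fin.pigeonhole (n<1+n N) (λ i → fromℕ< (σ^< (toℕ i) x<N))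
  ... | i , j , i<j , eq =
    toℕ j ∸ toℕ i , m<n⇒0<n∸m i<j , ≤-trans (m∸n≤m (toℕ j) (toℕ i)) (≤-pred (Fin.toℕ<n j)) ,
    sym (σ^-injective (toℕ i) x<N (σ^< (toℕ j ∸ toℕ i) x<N) σⁱx≡σⁱσᵈx)
    where
      open ≡-Reasoning
      σⁱx≡σⁱσᵈx : σ^ (toℕ i) x ≡ σ^ (toℕ i) (σ^ (toℕ j ∸ toℕ i) x)
      σⁱx≡σⁱσᵈx = begin
        σ^ (toℕ i) x                            ≡⟨ Fin.toℕ-fromℕ< _ ⟨
        toℕ (fromℕ< (σ^< (toℕ i) x<N))          ≡⟨ cong toℕ eq ⟩
        toℕ (fromℕ< (σ^< (toℕ j) x<N))          ≡⟨ Fin.toℕ-fromℕ< _ ⟩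
        σ^ (toℕ j) x                            ≡⟨ cong (λ k → σ^ k x) (m+[n∸m]≡n (<⇒≤ i<j)) ⟨
        σ^ (toℕ i + (toℕ j ∸ toℕ i)) x          ≡⟨ σ^-+ (toℕ i) _ x ⟩
        σ^ (toℕ i) (σ^ (toℕ j ∸ toℕ i) x)       ∎

  σ^∈walk : ∀ {i k} x → i ≤ k → σ^ i x ∈ alternatingWalk k x
  σ^∈walk {zero}  {zero}  x _ = here refl
  σ^∈walk {zero}  {suc k} x _ = here refl
  σ^∈walk {suc i} {suc k} x (s≤s i≤k) rewrite σ^-suc i x = there (there (σ^∈walk (σ x) i≤k))

  cσ^∈walk : ∀ {i k} x → i < k → c (σ^ i x) ∈ alternatingWalk k x
  cσ^∈walk {zero}  {suc k} x _ = there (here refl)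
  cσ^∈walk {suc i} {suc k} x (s≤s i<k) rewrite σ^-suc i x = there (there (cσ^∈walk (σ x) i<k))

  module _ {x : ℕ} (x<N : x < N) where

    Orbit : ℕ → Set
    Orbit y = ∃[ j ] (y ≡ σ^ j x ⊎ y ≡ c (σ^ j x))

    orbit-c : ∀ {y} → Orbit y → Orbit (c y)
    orbit-c (j , inj₁ refl) = j , inj₂ refl
    orbit-c (j , inj₂ refl) = j , inj₁ (c-involutive (σ^< j x<N))

    orbit-r : ∀ {y} → Orbit y → Orbit (r y)
    orbit-r (j , inj₂ refl) = suc j , inj₁ refl
    orbit-r (suc j , inj₁ refl) = j , inj₂ (r-involutive (c< (σ^< j x<N)))
    orbit-r (zero , inj₁ refl) with period x<N
    ... | suc p , _ , _ , σᵖx≡x = p , inj₂ (trans (cong r (sym σᵖx≡x)) (r-involutive (c< (σ^< p x<N))))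

    orbit-step : ∀ {y z} → SymClosure Step y z → Orbit y → Orbit z
    orbit-step (fwd (inj₁ (_ , refl))) o = orbit-c o
    orbit-step (fwd (inj₂ (_ , refl))) o = orbit-r o
    orbit-step (bwd (inj₁ (z<N , refl))) o = subst Orbit (c-involutive z<N) (orbit-c o)
    orbit-step (bwd (inj₂ (z<N , refl))) o = subst Orbit (r-involutive z<N) (orbit-r o)

    orbit-closed : ∀ {y z} → EqClosure Step y z → Orbit y → Orbit z
    orbit-closed ε o = o
    orbit-closed (s ◅ p) o = orbit-closed p (orbit-step s o)

    σ^-mod-period : ∀ j → ∃[ i ] i < N × σ^ j x ≡ σ^ i x
    σ^-mod-period j with period x<N
    ... | p , 0<p , p≤N , σᵖx≡x with reduce j
      where
        reduce : ∀ j → ∃[ i ] i < p × σ^ j x ≡ σ^ i x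
        reduce zero = 0 , 0<p , refl
        reduce (suc j) with reduce j
        ... | i , i<p , eq with suc i <? p
        ...   | yes 1+i<p = suc i , 1+i<p , cong σ eq
        ...   | no 1+i≮p =
          0 , 0<p , trans (cong σ eq) (trans (cong (λ k → σ^ k x) (≤-antisym i<p (≮⇒≥ 1+i≮p))) σᵖx≡x)
    ... | i , i<p , eq = i , <-≤-trans i<p p≤N , eq

    orbit⊆walk : ∀ {y} → Orbit y → y ∈ alternatingWalk N x
    orbit⊆walk (j , inj₁ refl) with σ^-mod-period j
    ... | i , i<N , eq rewrite eq = σ^∈walk x (<⇒≤ i<N)
    orbit⊆walk (j , inj₂ refl) with σ^-mod-period j
    ... | i , i<N , eq rewrite eq = cσ^∈walk x i<N

  walk-complete : ∀ {x y} → x < N → EqClosure Step x y → y ∈ alternatingWalk N x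
  walk-complete x<N p = orbit⊆walk x<N (orbit-closed x<N p (0 , inj₁ refl))

  least : ℕ → Bool
  least x = all (λ y → does (x ≤? y)) (alternatingWalk N x)

  connected⇒not-least : Connected N Step → ∀ {x} → 0 < x → x < N → least x ≡ false
  connected⇒not-least conn 0<x x<N =
    all-false⇐ _ (walk-complete x<N (conn x<N)) (Equivalence.from ≤?-false⇔> 0<x)

  not-least⇒connected : (∀ {x} → 0 < x → x < N → least x ≡ false) → Connected N Step
  not-least⇒connected not-least {x} = <-rec (λ x → x < N → EqClosure Step x 0) reach x
    where
      reach : ∀ x → (∀ {y} → y < x → y < N → EqClosure Step y 0) → x < N → EqClosure Step x 0
      reach zero    _  _   = ε
      reach (suc x) ih x<N
        with y , y∈ , ¬x≤y ← all-false⇒ _ (alternatingWalk N (suc x)) (not-least (s≤s z≤n) x<N) =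
        walk-sound N x<N y∈ ◅◅ ih y<x (<-trans y<x x<N)
        where y<x = Equivalence.to ≤?-false⇔> ¬x≤y

-- Defs keeps the helpers of ribbon, boundaryComponents and κ private.  Each one is recovered as
-- the solution of a metavariable: a public definition is unfolded, the operators around the
-- helper are abstracted by `with`, and refl forces the unfolding to match a term in the meta.
mutual
  half : ℕ → ℕ
  half = _

  isOdd : ℕ → Bool
  isOdd = _

  private
    capture-half-isOdd : ∀ x → ribbon [] x ≡ ribbon [] x
    capture-half-isOdd x with if_then_else_ {A = ℕ} | _+_ | not
    ... | ite | add | neg =
      refl {x = ite (neg (isOdd x)) (suc (add (half x) (add (half x) 0))) (add (half x) (add (half x) 0))}

mutual
  signAt : SignedRotation → ℕ → Bool
  signAt = _

  private
    capture-signAt : ∀ w x → ribbon w x ≡ ribbon w x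
    capture-signAt w x with half x
    ... | p with if_then_else_ {A = ℕ} | if_then_else_ {A = Bool} | _xor_ | not
    ... | ite | iteᵇ | xor | neg = refl {x = ite (iteᵇ (xor (signAt w p) _) (isOdd x) (neg (isOdd x))) _ _}

mutual
  labelAt∷ : Occ → SignedRotation → ℕ → ℕ
  labelAt∷ = _

  private
    capture-labelAt∷ : ∀ o os x → ribbon (o ∷ os) x ≡ ribbon (o ∷ os) x
    capture-labelAt∷ o os x with half x
    ... | p with if_then_else_ {A = ℕ} | _+_ | _∧_ | _≡ᵇ_
    ... | ite | add | and | eqᵇ =
      refl {x = ite _ (suc (add (ite (and (eqᵇ (proj₁ o) (labelAt∷ o os p)) _) _ _) _)) _}

mutual
  partnerFrom : SignedRotation → ℕ → ℕ → ℕ → ℕ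
  partnerFrom = _

  private
    capture-partnerFrom : ∀ o os x → ribbon (o ∷ os) x ≡ ribbon (o ∷ os) x
    capture-partnerFrom o os x with half x
    ... | p with labelAt∷ o os p | 1
    ... | l | i with if_then_else_ {A = ℕ} | _+_
    ... | ite | add = refl {x = ite _ (suc (add (ite _ _ (partnerFrom os l p i)) _)) _}

mutual
  countℕ : (ℕ → Bool) → List ℕ → ℕ
  countℕ = _

  private
    capture-countℕ : ∀ o os → boundaryComponents (o ∷ os) ≡ boundaryComponents (o ∷ os)
    capture-countℕ o os with isLeast (o ∷ os) | applyUpTo suc (2 * length (o ∷ os) ∸ 1)
    ... | P | xs with if_then_else_ {A = ℕ}
    ... | ite = refl {x = ite _ (suc (countℕ P xs)) _}

mutual
  countQuasiTrees : (n : ℕ) → SignedRotation → List (EdgeSet n) → ℕ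
  countQuasiTrees = _

  private
    capture-countQuasiTrees : ∀ n w → κ n w ≡ κ n w
    capture-countQuasiTrees n w with allEdgeSets n
    ... | Fs = refl {x = countQuasiTrees n w Fs}

κ≡count : ∀ n w → κ n w ≡ count (λ F → isQuasiTree (restrict F w)) (allEdgeSets n)
κ≡count n w = count-unique _ (countQuasiTrees n w) refl (λ _ _ → refl) (allEdgeSets n)

boundaryComponents≡count : ∀ o os →
  boundaryComponents (o ∷ os) ≡ count (isLeast (o ∷ os)) (upTo (2 * length (o ∷ os)))
boundaryComponents≡count o os =
  count-unique _ (countℕ (isLeast (o ∷ os))) refl (λ _ _ → refl) (upTo (2 * length (o ∷ os)))

-- Boundaries and faces of orientable bouquets

left right : ℕ → ℕ
left p = 2 * p
right p = suc (2 * p)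

data Endpoint : ℕ → Set where
  left-end  : ∀ p → Endpoint (left p)
  right-end : ∀ p → Endpoint (right p)

2*suc : ∀ p → 2 * suc p ≡ suc (suc (2 * p))
2*suc p = cong suc (+-suc p (p + 0))

endpoint : ∀ x → Endpoint x
endpoint zero = left-end 0
endpoint (suc x) with endpoint x
... | left-end p  = right-end p
... | right-end p = subst Endpoint (2*suc p) (left-end (suc p))

half-left : ∀ p → half (left p) ≡ p
half-left zero = refl
half-left (suc p) rewrite +-suc p (p + 0) = cong suc (half-left p)

half-right : ∀ p → half (right p) ≡ p
half-right zero = refl
half-right (suc p) rewrite +-suc p (p + 0) = cong suc (half-right p)

isOdd-left : ∀ p → isOdd (left p) ≡ false
isOdd-left zero = refl
isOdd-left (suc p) rewrite +-suc p (p + 0) = isOdd-left p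

isOdd-right : ∀ p → isOdd (right p) ≡ true
isOdd-right zero = refl
isOdd-right (suc p) rewrite +-suc p (p + 0) = isOdd-right p

left<left : ∀ {p m} → p < m → left p < left m
left<left = *-monoʳ-< 2

right<left : ∀ {p m} → p < m → right p < left m
right<left {p} {m} p<m = ≤-trans (≤-reflexive (sym (2*suc p))) (*-monoʳ-≤ 2 p<m)

left<left⁻¹ : ∀ {p m} → left p < left m → p < m
left<left⁻¹ {p} {m} = *-cancelˡ-< 2 p m

right<left⁻¹ : ∀ {p m} → right p < left m → p < m
right<left⁻¹ = left<left⁻¹ ∘ <-trans (n<1+n _)

-- Written as in Defs.corner, so that corner-right and corner-left hold by unfolding.
next prev : ℕ → ℕ → ℕ
next m p = suc p % suc (m ∸ 1)
prev m q = (q + (m ∸ 1)) % suc (m ∸ 1)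

corner-right : ∀ m p → corner m (right p) ≡ left (next m p)
corner-right m p rewrite isOdd-right p | half-right p = refl

corner-left : ∀ m q → corner m (left q) ≡ right (prev m q)
corner-left m q rewrite isOdd-left q | half-left q = refl

next-suc : ∀ {m p} → suc p < m → next m p ≡ suc p
next-suc {suc k} = m<n⇒m%n≡m

next-last : ∀ {m p} → suc p ≡ m → next m p ≡ 0
next-last {p = p} refl = n%n≡0 (suc p)

prev-zero : ∀ {m q} → suc q ≡ m → prev m 0 ≡ q
prev-zero refl = m<n⇒m%n≡m ≤-refl

prev-suc : ∀ {m q} → q < m → prev m (suc q) ≡ q
prev-suc {suc k} {q} q<1+k = begin
  (suc q + k) % suc k ≡⟨ cong (_% suc k) (sym (+-suc q k)) ⟩
  (q + suc k) % suc k ≡⟨ [m+n]%n≡m%n q (suc k) ⟩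
  q % suc k           ≡⟨ m<n⇒m%n≡m q<1+k ⟩
  q                   ∎
  where open ≡-Reasoning

next< : ∀ {m} p → 0 < m → next m p < m
next< {suc k} p _ = m%n<n (suc p) (suc k)

prev< : ∀ {m} q → 0 < m → prev m q < m
prev< {suc k} q _ = m%n<n (q + k) (suc k)

next-prev : ∀ {m q} → q < m → next m (prev m q) ≡ q
next-prev {suc k} {zero}  _       rewrite prev-zero {suc k} {k} refl = next-last {suc k} {k} refl
next-prev {suc k} {suc q} 1+q<1+k rewrite prev-suc {suc k} (<-trans (n<1+n q) 1+q<1+k) = next-suc 1+q<1+k

prev-next : ∀ {m p} → p < m → prev m (next m p) ≡ p
prev-next {suc k} {p} p<1+k with m≤n⇒m<n∨m≡n (≤-pred p<1+k)
... | inj₁ p<k  rewrite next-suc {suc k} (s≤s p<k) = prev-suc p<1+k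
... | inj₂ refl rewrite next-last {suc k} {k} refl = prev-zero refl

next-prev-last : ∀ {m} → 0 < m → next m (prev m m) ≡ 0
next-prev-last {suc k} _ rewrite prev-suc {suc k} {k} ≤-refl = next-last {suc k} {k} refl

labelAt : SignedRotation → ℕ → ℕ
labelAt []       _       = 0
labelAt (o ∷ os) zero    = proj₁ o
labelAt (o ∷ os) (suc p) = labelAt os p

labelAt∷≡labelAt : ∀ o os p → labelAt∷ o os p ≡ labelAt (o ∷ os) p
labelAt∷≡labelAt o os       zero    = refl
labelAt∷≡labelAt o []       (suc p) = refl
labelAt∷≡labelAt o (o′ ∷ os) (suc p) = labelAt∷≡labelAt o′ os p

partner : SignedRotation → ℕ → ℕ
partner w p = partnerFrom w (labelAt w p) p 0

Orientable : SignedRotation → Set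
Orientable = All (λ o → proj₂ o ≡ false)

signAt-orientable : ∀ {w} → Orientable w → ∀ p → signAt w p ≡ false
signAt-orientable []         p       = refl
signAt-orientable (o≡ ∷ _)   zero    = o≡
signAt-orientable (_ ∷ ors)  (suc p) = signAt-orientable ors p

module _ {o : Occ} {os : SignedRotation} (or : Orientable (o ∷ os)) where

  ribbon-left : ∀ p → ribbon (o ∷ os) (left p) ≡ right (partner (o ∷ os) p)
  ribbon-left p rewrite half-left p | isOdd-left p | labelAt∷≡labelAt o os p
                      | signAt-orientable or p | signAt-orientable or (partner (o ∷ os) p) = refl

  ribbon-right : ∀ p → ribbon (o ∷ os) (right p) ≡ left (partner (o ∷ os) p)
  ribbon-right p rewrite half-right p | isOdd-right p | labelAt∷≡labelAt o os p
                       | signAt-orientable or p | signAt-orientable or (partner (o ∷ os) p) = refl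

PartnerInvolutive : SignedRotation → Set
PartnerInvolutive w = ∀ {p} → p < length w → partner w p < length w × partner w (partner w p) ≡ p

BoundaryEdge : SignedRotation → Rel ℕ 0ℓ
BoundaryEdge w = Edge (2 * length w) (corner (length w)) ∪ Edge (2 * length w) (ribbon w)

module _ {k : ℕ} where

  corner< : ∀ {x} → x < left (suc k) → corner (suc k) x < left (suc k)
  corner< {x} _ with endpoint x
  ... | left-end q  rewrite corner-left (suc k) q  = right<left (prev< q (s≤s z≤n))
  ... | right-end p rewrite corner-right (suc k) p = left<left (next< p (s≤s z≤n))

  corner-involutive : ∀ {x} → x < left (suc k) → corner (suc k) (corner (suc k) x) ≡ x
  corner-involutive {x} x< with endpoint x
  ... | left-end q  rewrite corner-left (suc k) q | corner-right (suc k) (prev (suc k) q) =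
    cong left (next-prev {suc k} (left<left⁻¹ {q} x<))
  ... | right-end p rewrite corner-right (suc k) p | corner-left (suc k) (next (suc k) p) =
    cong right (prev-next {suc k} (right<left⁻¹ {p} x<))

module _ {o : Occ} {os : SignedRotation} (or : Orientable (o ∷ os)) (inv : PartnerInvolutive (o ∷ os)) where

  ribbon< : ∀ {x} → x < left (length (o ∷ os)) → ribbon (o ∷ os) x < left (length (o ∷ os))
  ribbon< {x} x< with endpoint x
  ... | left-end p  rewrite ribbon-left or p  = right<left (proj₁ (inv (left<left⁻¹ {p} x<)))
  ... | right-end p rewrite ribbon-right or p = left<left (proj₁ (inv (right<left⁻¹ {p} x<)))

  ribbon-involutive : ∀ {x} → x < left (length (o ∷ os)) → ribbon (o ∷ os) (ribbon (o ∷ os) x) ≡ x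
  ribbon-involutive {x} x< with endpoint x
  ... | left-end p  rewrite ribbon-left or p | ribbon-right or (partner (o ∷ os) p) =
    cong left (proj₂ (inv (left<left⁻¹ {p} x<)))
  ... | right-end p rewrite ribbon-right or p | ribbon-left or (partner (o ∷ os) p) =
    cong right (proj₂ (inv (right<left⁻¹ {p} x<)))

  private
    N = 2 * length (o ∷ os)
    module Boundary = InvolutionWalk N (corner (length (o ∷ os))) (ribbon (o ∷ os))
                                     corner< corner-involutive ribbon< ribbon-involutive

  walk≡ : ∀ k x → walk (o ∷ os) k x ≡ Boundary.alternatingWalk k x
  walk≡ zero    x = refl
  walk≡ (suc k) x = cong (λ ys → x ∷ corner (length (o ∷ os)) x ∷ ys) (walk≡ k _)

  isLeast≡least : ∀ x → isLeast (o ∷ os) x ≡ Boundary.least x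
  isLeast≡least x = cong (all (λ y → does (x ≤? y))) (walk≡ N x)

  isLeast-0 : isLeast (o ∷ os) 0 ≡ true
  isLeast-0 = all-true (walk (o ∷ os) N 0)
    where
      all-true : ∀ ys → all (λ y → does (0 ≤? y)) ys ≡ true
      all-true []       = refl
      all-true (_ ∷ ys) = all-true ys

  isQuasiTree≡ : isQuasiTree (o ∷ os) ≡ (count (isLeast (o ∷ os)) (applyUpTo suc (N ∸ 1)) ≡ᵇ 0)
  isQuasiTree≡ rewrite boundaryComponents≡count o os | isLeast-0 = refl

  isQuasiTree⇔connected : isQuasiTree (o ∷ os) ≡ true ⇔ Connected N (BoundaryEdge (o ∷ os))
  isQuasiTree⇔connected = mk⇔ to from
    where
      rest = applyUpTo suc (N ∸ 1)

      ∈rest : ∀ {x} → 0 < x → x < N → x ∈ rest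
      ∈rest {suc x} _ x<N = ∈-applyUpTo⁺ suc (≤-pred x<N)

      ∈rest⁻ : ∀ {x} → x ∈ rest → 0 < x × x < N
      ∈rest⁻ x∈ with _ , i<N-1 , refl ← ∈-applyUpTo⁻ suc x∈ = s≤s z≤n , s≤s i<N-1

      to : isQuasiTree (o ∷ os) ≡ true → Connected N (BoundaryEdge (o ∷ os))
      to qt = Boundary.not-least⇒connected λ {x} 0<x x<N →
        trans (sym (isLeast≡least x)) (count≡0⇒ (isLeast (o ∷ os)) count≡0 (∈rest 0<x x<N))
        where count≡0 = ≡ᵇ⇒≡ _ 0 (Equivalence.from T-≡ (trans (sym isQuasiTree≡) qt))

      from : Connected N (BoundaryEdge (o ∷ os)) → isQuasiTree (o ∷ os) ≡ true
      from conn = trans isQuasiTree≡ (Equivalence.to T-≡ (≡⇒≡ᵇ _ 0 (count≡0⇐ (isLeast (o ∷ os)) none)))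
        where
          none : ∀ {x} → x ∈ rest → isLeast (o ∷ os) x ≡ false
          none {x} x∈ with 0<x , x<N ← ∈rest⁻ x∈ =
            trans (isLeast≡least x) (Boundary.connected⇒not-least conn 0<x x<N)

-- From the right end of position p the boundary runs along a corner to the left end of the next
-- position and then along its ribbon to the right end of the partner.
τ : SignedRotation → ℕ → ℕ
τ w p = partner w (next (length w) p)

FaceEdge : SignedRotation → Rel ℕ 0ℓ
FaceEdge w = Edge (length w) (τ w)

FaceConnected : SignedRotation → Set
FaceConnected w = Connected (length w) (FaceEdge w)

module _ {o : Occ} {os : SignedRotation} (or : Orientable (o ∷ os)) (inv : PartnerInvolutive (o ∷ os)) where
  private
    w = o ∷ os
    m = length w

  position : ℕ → ℕ
  position x = if isOdd x then half x else prev m (half x)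

  position-left : ∀ q → position (left q) ≡ prev m q
  position-left q rewrite isOdd-left q | half-left q = refl

  position-right : ∀ p → position (right p) ≡ p
  position-right p rewrite isOdd-right p | half-right p = refl

  right-face-edge : ∀ {p q} → FaceEdge w p q → EqClosure (BoundaryEdge w) (right p) (right q)
  right-face-edge (p<m , refl) =
    fwd (inj₁ (right<left p<m , corner-right m _)) ◅
    fwd (inj₂ (left<left (next< _ (s≤s z≤n)) , ribbon-left or _)) ◅ ε

  position-boundary-edge : ∀ {x y} → BoundaryEdge w x y → EqClosure (FaceEdge w) (position x) (position y)
  position-boundary-edge {x} (inj₁ (x< , refl)) with endpoint x
  ... | left-end q  rewrite corner-left m q | position-left q | position-right (prev m q) = ε
  ... | right-end p rewrite corner-right m p | position-right p | position-left (next m p)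
                          | prev-next {m} (right<left⁻¹ {p} x<) = ε
  position-boundary-edge {x} (inj₂ (x< , refl)) with endpoint x
  ... | left-end q  rewrite ribbon-left or q | position-left q | position-right (partner w q) =
    fwd (prev< q (s≤s z≤n) , cong (partner w) (next-prev {m} (left<left⁻¹ {q} x<))) ◅ ε
  ... | right-end p rewrite ribbon-right or p | position-right p | position-left (partner w p) =
    bwd (prev< (partner w p) (s≤s z≤n) ,
         trans (cong (partner w) (next-prev {m} (proj₁ (inv p<m)))) (proj₂ (inv p<m))) ◅ ε
    where p<m = right<left⁻¹ {p} x<

  boundary⇔face-connected : Connected (2 * m) (BoundaryEdge w) ⇔ FaceConnected w
  boundary⇔face-connected = mk⇔
    (connected-onto position position-boundary-edge λ {p} p<m →
      right p , right<left p<m , subst (EqClosure (FaceEdge w) p) (sym (position-right p)) ε)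
    (connected-onto right right-face-edge λ {x} x< → onto x x<)
    where
      onto : ∀ x → x < 2 * m → ∃[ p ] p < m × EqClosure (BoundaryEdge w) x (right p)
      onto x x< with endpoint x
      ... | left-end q  = prev m q , prev< q (s≤s z≤n) , fwd (inj₁ (x< , corner-left m q)) ◅ ε
      ... | right-end p = p , right<left⁻¹ {p} x< , ε

quasiTree⇔faceConnected : ∀ {w} → Orientable w → PartnerInvolutive w → isQuasiTree w ≡ true ⇔ FaceConnected w
quasiTree⇔faceConnected {[]}     _  _   = mk⇔ (λ _ ()) (λ _ → refl)
quasiTree⇔faceConnected {o ∷ os} or inv = ⇔.trans (isQuasiTree⇔connected or inv) (boundary⇔face-connected or inv)

τ-injective : ∀ {w} → PartnerInvolutive w →
              ∀ {x y} → x < length w → y < length w → τ w x ≡ τ w y → x ≡ y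
τ-injective {o ∷ os} inv {x} {y} x< y< τx≡τy = begin
  x                                 ≡⟨ prev-next {m} x< ⟨
  prev m (next m x)                 ≡⟨ cong (prev m) (proj₂ (inv (next< x (s≤s z≤n)))) ⟨
  prev m (partner w (τ w x))        ≡⟨ cong (prev m ∘ partner w) τx≡τy ⟩
  prev m (partner w (τ w y))        ≡⟨ cong (prev m) (proj₂ (inv (next< y (s≤s z≤n)))) ⟩
  prev m (next m y)                 ≡⟨ prev-next {m} y< ⟩
  y                                 ∎
  where
    open ≡-Reasoning
    w = o ∷ os
    m = length w

-- Partners in concatenated signed rotations

Fresh : ℕ → SignedRotation → Set
Fresh l = All (λ o → proj₁ o ≢ l)

punchIn : ℕ → ℕ → ℕ
punchIn zero    p       = suc p
punchIn (suc t) zero    = zero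
punchIn (suc t) (suc p) = suc (punchIn t p)

punchIn-< : ∀ {t p} → p < t → punchIn t p ≡ p
punchIn-< {suc t} {zero}  _         = refl
punchIn-< {suc t} {suc p} (s≤s p<t) = cong suc (punchIn-< p<t)

punchIn-≥ : ∀ {t p} → t ≤ p → punchIn t p ≡ suc p
punchIn-≥ {zero}  {p}     _         = refl
punchIn-≥ {suc t} {suc p} (s≤s t≤p) = cong suc (punchIn-≥ t≤p)

punchIn-suc : ∀ {t q} → suc q ≢ t → punchIn t (suc q) ≡ suc (punchIn t q)
punchIn-suc {zero}        {q}     _  = refl
punchIn-suc {suc zero}    {zero}  ne = ⊥-elim (ne refl)
punchIn-suc {suc (suc t)} {zero}  _  = refl
punchIn-suc {suc t}       {suc q} ne = cong suc (punchIn-suc (ne ∘ cong suc))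

module _ (o : Occ) {l : ℕ} where

  partnerFrom-skip∷ : ∀ v {p i} → proj₁ o ≢ l → partnerFrom (o ∷ v) l p i ≡ partnerFrom v l p (suc i)
  partnerFrom-skip∷ v o≢l rewrite dec-false (proj₁ o ≟ l) o≢l = refl

  partnerFrom-hit : ∀ v {p i} → proj₁ o ≡ l → i ≢ p → partnerFrom (o ∷ v) l p i ≡ i
  partnerFrom-hit v {p} {i} refl i≢p rewrite dec-true (proj₁ o ≟ proj₁ o) refl | dec-false (i ≟ p) i≢p = refl

  partnerFrom-self : ∀ v {p} → partnerFrom (o ∷ v) l p p ≡ partnerFrom v l p (suc p)
  partnerFrom-self v {p} rewrite dec-true (p ≟ p) refl with proj₁ o ≡ᵇ l
  ... | true  = refl
  ... | false = refl

≡ᵇ-punchIn-< : ∀ {i t} p → i < t → (i ≡ᵇ punchIn t p) ≡ (i ≡ᵇ p)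
≡ᵇ-punchIn-< {zero}  {suc t} zero    _         = refl
≡ᵇ-punchIn-< {zero}  {suc t} (suc p) _         = refl
≡ᵇ-punchIn-< {suc i} {suc t} zero    _         = refl
≡ᵇ-punchIn-< {suc i} {suc t} (suc p) (s≤s i<t) = ≡ᵇ-punchIn-< p i<t

≡ᵇ-punchIn-≥ : ∀ {i t} p → t ≤ i → (suc i ≡ᵇ punchIn t p) ≡ (i ≡ᵇ p)
≡ᵇ-punchIn-≥ {i}     {zero}  p       _         = refl
≡ᵇ-punchIn-≥ {suc i} {suc t} zero    _         = refl
≡ᵇ-punchIn-≥ {suc i} {suc t} (suc p) (s≤s t≤i) = ≡ᵇ-punchIn-≥ p t≤i

module _ {l : ℕ} where

  partnerFrom-skip : ∀ u v {p i} → Fresh l u → partnerFrom (u ++ v) l p i ≡ partnerFrom v l p (i + length u)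
  partnerFrom-skip []      v {p} {i} []         = cong (partnerFrom v l p) (sym (+-identityʳ i))
  partnerFrom-skip (o ∷ u) v {p} {i} (o≢l ∷ fu) =
    trans (partnerFrom-skip∷ o (u ++ v) o≢l)
          (trans (partnerFrom-skip u v fu) (cong (partnerFrom v l p) (sym (+-suc i (length u)))))

  partnerFrom-absent : ∀ v {p i} → Fresh l v → partnerFrom v l p i ≡ p
  partnerFrom-absent []      []         = refl
  partnerFrom-absent (o ∷ v) (o≢l ∷ fv) = trans (partnerFrom-skip∷ o v o≢l) (partnerFrom-absent v fv)

  partnerFrom-++-fresh : ∀ v {t p i} → Fresh l t → partnerFrom (v ++ t) l p i ≡ partnerFrom v l p i
  partnerFrom-++-fresh []      {t} ft = partnerFrom-absent t ft
  partnerFrom-++-fresh (o ∷ v) {t} {p} {i} ft with (proj₁ o ≡ᵇ l) ∧ not (i ≡ᵇ p)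
  ... | true  = refl
  ... | false = partnerFrom-++-fresh v ft

  partnerFrom-shift : ∀ v {p i t} → t ≤ i → partnerFrom v l (punchIn t p) (suc i) ≡ punchIn t (partnerFrom v l p i)
  partnerFrom-shift []      _   = refl
  partnerFrom-shift (o ∷ v) {p} {i} {t} t≤i
    rewrite ≡ᵇ-punchIn-≥ p t≤i with (proj₁ o ≡ᵇ l) ∧ not (i ≡ᵇ p)
  ... | true  = sym (punchIn-≥ t≤i)
  ... | false = partnerFrom-shift v (m≤n⇒m≤1+n t≤i)

  partnerFrom-insert : ∀ u {o} v {p i} → proj₁ o ≢ l →
    partnerFrom (u ++ o ∷ v) l (punchIn (i + length u) p) i ≡ punchIn (i + length u) (partnerFrom (u ++ v) l p i)
  partnerFrom-insert []       {o} v {p} {i} o≢l rewrite +-identityʳ i =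
    trans (partnerFrom-skip∷ o v o≢l) (partnerFrom-shift v ≤-refl)
  partnerFrom-insert (o′ ∷ u) {o} v {p} {i} o≢l
    rewrite +-suc i (length u) | ≡ᵇ-punchIn-< {i} {suc (i + length u)} p (s≤s (m≤m+n i (length u)))
    with (proj₁ o′ ≡ᵇ l) ∧ not (i ≡ᵇ p)
  ... | true  = sym (punchIn-< (s≤s (m≤m+n i (length u))))
  ... | false = partnerFrom-insert u v o≢l

labelAt-++ˡ : ∀ u v {p} → p < length u → labelAt (u ++ v) p ≡ labelAt u p
labelAt-++ˡ (o ∷ u) v {zero}  _         = refl
labelAt-++ˡ (o ∷ u) v {suc p} (s≤s p<u) = labelAt-++ˡ u v p<u

labelAt-++ʳ : ∀ u v k → labelAt (u ++ v) (length u + k) ≡ labelAt v k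
labelAt-++ʳ []      v k = refl
labelAt-++ʳ (o ∷ u) v k = labelAt-++ʳ u v k

labelAt-punchIn : ∀ u o v p → labelAt (u ++ o ∷ v) (punchIn (length u) p) ≡ labelAt (u ++ v) p
labelAt-punchIn []       o v p       = refl
labelAt-punchIn (o′ ∷ u) o v zero    = refl
labelAt-punchIn (o′ ∷ u) o v (suc p) = labelAt-punchIn u o v p

labelAt-fresh : ∀ {l w p} → Fresh l w → p < length w → labelAt w p ≢ l
labelAt-fresh {p = zero}  (o≢l ∷ _)  _         = o≢l
labelAt-fresh {p = suc p} (_ ∷ fw)   (s≤s p<w) = labelAt-fresh fw p<w

partner-++-fresh : ∀ v t {p} → p < length v → Fresh (labelAt v p) t → partner (v ++ t) p ≡ partner v p
partner-++-fresh v t {p} p<v ft =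
  trans (cong (λ l → partnerFrom (v ++ t) l p 0) (labelAt-++ˡ v t p<v)) (partnerFrom-++-fresh v ft)

partner-insert : ∀ u o v {p} → proj₁ o ≢ labelAt (u ++ v) p →
                 partner (u ++ o ∷ v) (punchIn (length u) p) ≡ punchIn (length u) (partner (u ++ v) p)
partner-insert u o v {p} o≢l =
  trans (cong (λ l → partnerFrom (u ++ o ∷ v) l (punchIn (length u) p) 0) (labelAt-punchIn u o v p))
        (partnerFrom-insert u v o≢l)

module _ {l : ℕ} {u v : SignedRotation} {o₁ o₂ : Occ} {t : SignedRotation}
         (fu : Fresh l u) (fv : Fresh l v) (o₁≡l : proj₁ o₁ ≡ l) (o₂≡l : proj₁ o₂ ≡ l) where
  private
    w = u ++ o₁ ∷ v ++ o₂ ∷ t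

  partner-pair₁ : partner w (length u) ≡ suc (length u + length v)
  partner-pair₁ = begin
    partnerFrom w (labelAt w (length u)) (length u) 0
      ≡⟨ cong (λ l′ → partnerFrom w l′ (length u) 0) label≡l ⟩
    partnerFrom w l (length u) 0
      ≡⟨ partnerFrom-skip u _ fu ⟩
    partnerFrom (o₁ ∷ v ++ o₂ ∷ t) l (length u) (length u)
      ≡⟨ partnerFrom-self o₁ (v ++ o₂ ∷ t) ⟩
    partnerFrom (v ++ o₂ ∷ t) l (length u) (suc (length u))
      ≡⟨ partnerFrom-skip v _ fv ⟩
    partnerFrom (o₂ ∷ t) l (length u) (suc (length u + length v))
      ≡⟨ partnerFrom-hit o₂ t o₂≡l (m≢1+m+n (length u) ∘ sym) ⟩
    suc (length u + length v)
      ∎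
    where
      open ≡-Reasoning
      label≡l : labelAt w (length u) ≡ l
      label≡l = trans (cong (labelAt w) (sym (+-identityʳ (length u)))) (trans (labelAt-++ʳ u _ 0) o₁≡l)

  partner-pair₂ : partner w (suc (length u + length v)) ≡ length u
  partner-pair₂ = begin
    partnerFrom w (labelAt w q) q 0
      ≡⟨ cong (λ l′ → partnerFrom w l′ q 0) label≡l ⟩
    partnerFrom w l q 0
      ≡⟨ partnerFrom-skip u _ fu ⟩
    partnerFrom (o₁ ∷ v ++ o₂ ∷ t) l q (length u)
      ≡⟨ partnerFrom-hit o₁ (v ++ o₂ ∷ t) o₁≡l (m≢1+m+n (length u)) ⟩
    length u
      ∎
    where
      open ≡-Reasoning
      q = suc (length u + length v)
      label≡l : labelAt w q ≡ l
      label≡l = begin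
        labelAt w q                            ≡⟨ cong (labelAt w) (+-suc (length u) (length v)) ⟨
        labelAt w (length u + suc (length v))  ≡⟨ labelAt-++ʳ u _ (suc (length v)) ⟩
        labelAt (v ++ o₂ ∷ t) (length v)       ≡⟨ cong (labelAt (v ++ o₂ ∷ t)) (+-identityʳ (length v)) ⟨
        labelAt (v ++ o₂ ∷ t) (length v + 0)   ≡⟨ labelAt-++ʳ v _ 0 ⟩
        proj₁ o₂                               ≡⟨ o₂≡l ⟩
        l                                      ∎

module AdjacentPair {P : SignedRotation} {b : ℕ} (fresh : Fresh b P) (orientable : Orientable P)
                    (involutive : PartnerInvolutive P) where
  private
    B : Occ
    B = b , false
    α = length P

  W : SignedRotation
  W = P ++ B ∷ B ∷ []

  length-W : length W ≡ suc (suc α)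
  length-W = trans (length-++ P) (+-comm α 2)

  W-orientable : Orientable W
  W-orientable = Allₚ.++⁺ orientable (refl ∷ refl ∷ [])

  private
    partner-P : ∀ {p} → p < α → partner W p ≡ partner P p
    partner-P p<α = partner-++-fresh P _ p<α (b≢ ∷ b≢ ∷ [])
      where b≢ = labelAt-fresh fresh p<α ∘ sym

    partner-α : partner W α ≡ suc α
    partner-α = trans (partner-pair₁ {v = []} fresh [] refl refl) (cong suc (+-identityʳ α))

    partner-1+α : partner W (suc α) ≡ α
    partner-1+α = trans (cong (partner W ∘ suc) (sym (+-identityʳ α))) (partner-pair₂ {v = []} fresh [] refl refl)

    α<W : α < length W
    α<W = subst (α <_) (sym length-W) (m<n⇒m<1+n (n<1+n α))

    1+α<W : suc α < length W
    1+α<W = subst (suc α <_) (sym length-W) (n<1+n (suc α))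

  W-involutive : PartnerInvolutive W
  W-involutive {p} p<W with p <? α | p ≟ α
  ... | yes p<α | _ rewrite partner-P p<α | partner-P (proj₁ (involutive p<α)) =
    <-trans (proj₁ (involutive p<α)) α<W , proj₂ (involutive p<α)
  ... | no _ | yes refl rewrite partner-α | partner-1+α = 1+α<W , refl
  ... | no p≮α | no p≢α
    rewrite ≤-antisym (≤-pred (subst (p <_) length-W p<W)) (≤∧≢⇒< (≮⇒≥ p≮α) (p≢α ∘ sym))
          | partner-1+α | partner-α = α<W , refl

  W-not-quasiTree : isQuasiTree W ≡ false
  W-not-quasiTree = ¬-not λ qt →
    let connected = Equivalence.to (quasiTree⇔faceConnected W-orientable W-involutive) qt
    in 1+n≢n (fixed-point-isolated (τ-injective {W} W-involutive) α<W τα≡α refl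
                (connected α<W ◅◅ symmetric _ (connected 1+α<W)))
    where
      τα≡α : τ W α ≡ α
      τα≡α = begin
        partner W (next (length W) α)     ≡⟨ cong (λ n → partner W (next n α)) length-W ⟩
        partner W (next (suc (suc α)) α)  ≡⟨ cong (partner W) (next-suc (n<1+n (suc α))) ⟩
        partner W (suc α)                 ≡⟨ partner-1+α ⟩
        α                                 ∎
        where open ≡-Reasoning

module InterlacedPairs {P Q : SignedRotation} {a b : ℕ} (a≢b : a ≢ b)
                       (a∉P : Fresh a P) (a∉Q : Fresh a Q) (b∉P : Fresh b P) (b∉Q : Fresh b Q)
                       (P-orientable : Orientable P) (Q-orientable : Orientable Q) where
  private
    A B : Occ
    A = a , false
    B = b , false

  W′ W : SignedRotation
  W′ = P ++ Q
  W  = P ++ A ∷ (Q ++ B ∷ A ∷ B ∷ [])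

  private
    open ≡-Reasoning

    α m : ℕ
    α = length P
    m = length W′

    a₁ b₁ a₂ b₂ : ℕ
    a₁ = α
    b₁ = suc m
    a₂ = suc b₁
    b₂ = suc a₂

    E : ℕ → ℕ
    E = punchIn α

    α≤m : α ≤ m
    α≤m = subst (α ≤_) (sym (length-++ P)) (m≤m+n α (length Q))

    length-W : length W ≡ suc b₂
    length-W = begin
      length W                                  ≡⟨ length-++ P ⟩
      α + suc (length (Q ++ B ∷ A ∷ B ∷ []))     ≡⟨ cong (λ n → α + suc n) (length-++ Q) ⟩
      α + suc (length Q + 3)                     ≡⟨ +-suc α _ ⟩
      suc (α + (length Q + 3))                   ≡⟨ cong suc (+-assoc α (length Q) 3) ⟨
      suc (α + length Q + 3)                     ≡⟨ cong (λ n → suc (n + 3)) (length-++ P) ⟨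
      suc (m + 3)                                ≡⟨ cong suc (+-comm m 3) ⟩
      suc b₂                                     ∎

    <W : ∀ {p} → p ≤ b₂ → p < length W
    <W p≤b₂ = subst (_ <_) (sym length-W) (s≤s p≤b₂)

    E≤m : ∀ {q} → q < m → E q ≤ m
    E≤m {q} q<m with q <? α
    ... | yes q<α rewrite punchIn-< q<α = <⇒≤ q<m
    ... | no q≮α  rewrite punchIn-≥ (≮⇒≥ q≮α) = q<m

    E<W : ∀ {q} → q < m → E q < length W
    E<W q<m = <W (≤-trans (E≤m q<m) (≤-trans (n≤1+n m) (≤-trans (n≤1+n _) (n≤1+n _))))

    W-orientable : Orientable W
    W-orientable = Allₚ.++⁺ P-orientable (refl ∷ Allₚ.++⁺ Q-orientable (refl ∷ refl ∷ refl ∷ []))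

    W′-orientable : Orientable W′
    W′-orientable = Allₚ.++⁺ P-orientable Q-orientable

    a∉W′ : Fresh a W′
    a∉W′ = Allₚ.++⁺ a∉P a∉Q

    b∉W′ : Fresh b W′
    b∉W′ = Allₚ.++⁺ b∉P b∉Q

    partner-E : ∀ {q} → q < m → partner W (E q) ≡ E (partner W′ q)
    partner-E {q} q<m = begin
      partner W (E q)
        ≡⟨ partner-insert P A (Q ++ G) (λ eq → a≢l (sym (trans eq label≡))) ⟩
      E (partner (P ++ (Q ++ G)) q)
        ≡⟨ cong (λ w → E (partner w q)) (++-assoc P Q G) ⟨
      E (partner (W′ ++ G) q)
        ≡⟨ cong E (partner-++-fresh W′ G q<m (b≢l ∘ sym ∷ a≢l ∘ sym ∷ b≢l ∘ sym ∷ [])) ⟩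
      E (partner W′ q)
        ∎
      where
        G = B ∷ A ∷ B ∷ []
        a≢l = labelAt-fresh a∉W′ q<m
        b≢l = labelAt-fresh b∉W′ q<m
        label≡ : labelAt (P ++ (Q ++ G)) q ≡ labelAt W′ q
        label≡ = trans (cong (λ w → labelAt w q) (sym (++-assoc P Q G))) (labelAt-++ˡ W′ G q<m)

    Wᵃ Wᵇ : SignedRotation
    Wᵃ = P ++ A ∷ ((Q ++ B ∷ []) ++ A ∷ B ∷ [])
    Wᵇ = (P ++ A ∷ Q) ++ B ∷ (A ∷ []) ++ B ∷ []

    Wᵃ≡W : Wᵃ ≡ W
    Wᵃ≡W = cong (λ x → P ++ A ∷ x) (++-assoc Q (B ∷ []) (A ∷ B ∷ []))

    Wᵇ≡W : Wᵇ ≡ W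
    Wᵇ≡W = ++-assoc P (A ∷ Q) (B ∷ A ∷ B ∷ [])

    a₂≡ : suc (α + length (Q ++ B ∷ [])) ≡ a₂
    a₂≡ = cong suc (begin
      α + length (Q ++ B ∷ [])  ≡⟨ cong (α +_) (trans (length-++ Q) (+-comm (length Q) 1)) ⟩
      α + suc (length Q)        ≡⟨ +-suc α (length Q) ⟩
      suc (α + length Q)        ≡⟨ cong suc (length-++ P) ⟨
      b₁                        ∎)

    b₁≡ : length (P ++ A ∷ Q) ≡ b₁
    b₁≡ = trans (length-++ P) (trans (+-suc α (length Q)) (cong suc (sym (length-++ P))))

    b₂≡ : suc (length (P ++ A ∷ Q) + 1) ≡ b₂
    b₂≡ = cong suc (trans (cong (_+ 1) b₁≡) (+-comm b₁ 1))

    a∉Q++B : Fresh a (Q ++ B ∷ [])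
    a∉Q++B = Allₚ.++⁺ a∉Q (a≢b ∘ sym ∷ [])

    b∉P++A++Q : Fresh b (P ++ A ∷ Q)
    b∉P++A++Q = Allₚ.++⁺ b∉P (a≢b ∷ b∉Q)

    partner-a₁ : partner W a₁ ≡ a₂
    partner-a₁ = begin
      partner W α                     ≡⟨ cong (λ w → partner w α) Wᵃ≡W ⟨
      partner Wᵃ α                    ≡⟨ partner-pair₁ {o₁ = A} {o₂ = A} {t = B ∷ []} a∉P a∉Q++B refl refl ⟩
      suc (α + length (Q ++ B ∷ []))  ≡⟨ a₂≡ ⟩
      a₂                              ∎

    partner-a₂ : partner W a₂ ≡ a₁
    partner-a₂ = begin
      partner W a₂
        ≡⟨ cong (λ w → partner w a₂) Wᵃ≡W ⟨
      partner Wᵃ a₂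
        ≡⟨ cong (partner Wᵃ) a₂≡ ⟨
      partner Wᵃ (suc (α + length (Q ++ B ∷ [])))
        ≡⟨ partner-pair₂ {o₁ = A} {o₂ = A} {t = B ∷ []} a∉P a∉Q++B refl refl ⟩
      α
        ∎

    partner-b₁ : partner W b₁ ≡ b₂
    partner-b₁ = begin
      partner W b₁
        ≡⟨ cong (λ w → partner w b₁) Wᵇ≡W ⟨
      partner Wᵇ b₁
        ≡⟨ cong (partner Wᵇ) b₁≡ ⟨
      partner Wᵇ (length (P ++ A ∷ Q))
        ≡⟨ partner-pair₁ {o₁ = B} {o₂ = B} {t = []} b∉P++A++Q (a≢b ∷ []) refl refl ⟩
      suc (length (P ++ A ∷ Q) + 1)
        ≡⟨ b₂≡ ⟩
      b₂
        ∎

    partner-b₂ : partner W b₂ ≡ b₁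
    partner-b₂ = begin
      partner W b₂
        ≡⟨ cong (λ w → partner w b₂) Wᵇ≡W ⟨
      partner Wᵇ b₂
        ≡⟨ cong (partner Wᵇ) b₂≡ ⟨
      partner Wᵇ (suc (length (P ++ A ∷ Q) + 1))
        ≡⟨ partner-pair₂ {o₁ = B} {o₂ = B} {t = []} b∉P++A++Q (a≢b ∷ []) refl refl ⟩
      length (P ++ A ∷ Q)
        ≡⟨ b₁≡ ⟩
      b₁
        ∎

    data Position : ℕ → Set where
      inner : ∀ {q} → q < m → Position (E q)
      at-a₁ : Position a₁
      at-b₁ : Position b₁
      at-a₂ : Position a₂
      at-b₂ : Position b₂

    classify : ∀ {p} → p < length W → Position p
    classify {p} p<W with <-cmp p α
    ... | tri< p<α _ _  = subst Position (punchIn-< p<α) (inner (<-≤-trans p<α α≤m))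
    ... | tri≈ _ refl _ = at-a₁
    classify {suc q} p<W | tri> _ _ α<p with q <? m
    ... | yes q<m = subst Position (punchIn-≥ (≤-pred α<p)) (inner q<m)
    ... | no q≮m with d , refl ← m≤n⇒∃[o]m+o≡n (≮⇒≥ q≮m) =
      beyond d (≤-pred (subst (suc (m + d) <_) length-W p<W))
      where
        beyond : ∀ d → m + d < b₂ → Position (suc (m + d))
        beyond 0 _ rewrite +-identityʳ m = at-b₁
        beyond 1 _ rewrite +-comm m 1 = at-a₂
        beyond 2 _ rewrite +-comm m 2 = at-b₂
        beyond (suc (suc (suc d))) m+d<b₂ =
          ⊥-elim (<-irrefl refl (<-≤-trans m+d<b₂
            (≤-trans (≤-reflexive (+-comm 3 m)) (+-monoʳ-≤ m (s≤s (s≤s (s≤s z≤n)))))))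

    a₁<W : a₁ < length W
    a₁<W = <W (≤-trans α≤m (≤-trans (n≤1+n m) (≤-trans (n≤1+n _) (n≤1+n _))))

    b₁<W : b₁ < length W
    b₁<W = <W (≤-trans (n≤1+n _) (n≤1+n _))

    a₂<W : a₂ < length W
    a₂<W = <W (n≤1+n _)

    b₂<W : b₂ < length W
    b₂<W = <W ≤-refl

  W-involutive : PartnerInvolutive W′ → PartnerInvolutive W
  W-involutive inv′ p<W with classify p<W
  ... | inner q<m rewrite partner-E q<m | partner-E (proj₁ (inv′ q<m)) =
    E<W (proj₁ (inv′ q<m)) , cong E (proj₂ (inv′ q<m))
  ... | at-a₁ rewrite partner-a₁ | partner-a₂ = a₂<W , refl
  ... | at-a₂ rewrite partner-a₂ | partner-a₁ = a₁<W , refl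
  ... | at-b₁ rewrite partner-b₁ | partner-b₂ = b₂<W , refl
  ... | at-b₂ rewrite partner-b₂ | partner-b₁ = b₁<W , refl

  private
    τ-W : ∀ {p} → p < b₂ → τ W p ≡ partner W (suc p)
    τ-W p<b₂ = cong (partner W) (next-suc (<W p<b₂))

    E<b₂ : ∀ {q} → q < m → E q < b₂
    E<b₂ q<m = s≤s (≤-trans (E≤m q<m) (≤-trans (n≤1+n m) (n≤1+n _)))

    α<b₂ : α < b₂
    α<b₂ = s≤s (≤-trans α≤m (≤-trans (n≤1+n m) (n≤1+n _)))

    τ-a₂ : τ W a₂ ≡ b₁
    τ-a₂ = trans (τ-W ≤-refl) partner-b₂

    τ-b₁ : τ W b₁ ≡ a₁
    τ-b₁ = trans (τ-W (n≤1+n a₂)) partner-a₂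

    τ-b₂ : τ W b₂ ≡ partner W 0
    τ-b₂ = cong (partner W) (next-last (sym length-W))

    τ-E-regular : ∀ {q} → suc q < m → suc q ≢ α → τ W (E q) ≡ E (τ W′ q)
    τ-E-regular {q} 1+q<m 1+q≢α = begin
      τ W (E q)                  ≡⟨ τ-W (E<b₂ (<-trans (n<1+n q) 1+q<m)) ⟩
      partner W (suc (E q))      ≡⟨ cong (partner W) (punchIn-suc 1+q≢α) ⟨
      partner W (E (suc q))      ≡⟨ partner-E 1+q<m ⟩
      E (partner W′ (suc q))     ≡⟨ cong (E ∘ partner W′) (next-suc 1+q<m) ⟨
      E (τ W′ q)                 ∎

    τ-E-before-a₁ : ∀ {q} → suc q ≡ α → τ W (E q) ≡ a₂
    τ-E-before-a₁ {q} 1+q≡α = begin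
      τ W (E q)          ≡⟨ cong (τ W) (punchIn-< (≤-reflexive 1+q≡α)) ⟩
      τ W q              ≡⟨ τ-W (<-trans (n<1+n q) (subst (_< b₂) (sym 1+q≡α) α<b₂)) ⟩
      partner W (suc q)  ≡⟨ cong (partner W) 1+q≡α ⟩
      partner W α        ≡⟨ partner-a₁ ⟩
      a₂                 ∎

    τ-E-last : ∀ {q} → suc q ≡ m → α ≤ q → τ W (E q) ≡ b₂
    τ-E-last {q} 1+q≡m α≤q = begin
      τ W (E q)          ≡⟨ cong (τ W) (trans (punchIn-≥ α≤q) 1+q≡m) ⟩
      τ W m              ≡⟨ τ-W (<-trans (n<1+n m) (<-trans (n<1+n b₁) (n<1+n a₂))) ⟩
      partner W b₁       ≡⟨ partner-b₁ ⟩
      b₂                 ∎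

    τ-a₁-inner : α < m → τ W a₁ ≡ E (partner W′ α)
    τ-a₁-inner α<m = trans (τ-W α<b₂) (trans (cong (partner W) (sym (punchIn-≥ ≤-refl))) (partner-E α<m))

    τ-a₁-last : α ≡ m → τ W a₁ ≡ b₂
    τ-a₁-last α≡m = trans (τ-W α<b₂) (trans (cong (partner W ∘ suc) α≡m) partner-b₁)

    τ-b₂-inner : 0 < α → τ W b₂ ≡ E (partner W′ 0)
    τ-b₂-inner 0<α =
      trans τ-b₂ (trans (cong (partner W) (sym (punchIn-< 0<α))) (partner-E (<-≤-trans 0<α α≤m)))

    τ-b₂-first : α ≡ 0 → τ W b₂ ≡ a₂
    τ-b₂-first α≡0 = trans τ-b₂ (trans (cong (partner W) (sym α≡0)) partner-a₁)

    data Successor (q : ℕ) : Set where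
      before-a₁ : suc q ≡ α → Successor q
      last      : suc q ≡ m → α ≤ q → Successor q
      regular   : suc q < m → suc q ≢ α → Successor q

    successor : ∀ {q} → q < m → Successor q
    successor {q} q<m with suc q ≟ α
    ... | yes 1+q≡α = before-a₁ 1+q≡α
    ... | no 1+q≢α with m≤n⇒m<n∨m≡n q<m
    ...   | inj₁ 1+q<m = regular 1+q<m 1+q≢α
    ...   | inj₂ 1+q≡m =
      last 1+q≡m (≤-pred (≤∧≢⇒< (subst (α ≤_) (sym 1+q≡m) α≤m) (1+q≢α ∘ sym)))

    -- The τ-path of W through a₂, b₁, a₁ (and b₂ when α = m) replaces the step of W′ from prev m α,
    -- and the one through b₂ (and a₂, b₁, a₁ when α = 0) the step from m ∸ 1; πa and πb are the
    -- positions where these paths return to W′.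
    πa πb : ℕ
    πa = τ W′ (prev m α)
    πb = τ W′ (prev m 0)

    πa≡πb : α ≡ 0 → πa ≡ πb
    πa≡πb α≡0 = cong (τ W′ ∘ prev m) α≡0

    πa-before-a₁ : ∀ {q} → suc q ≡ α → πa ≡ τ W′ q
    πa-before-a₁ {q} 1+q≡α =
      cong (τ W′) (trans (cong (prev m) (sym 1+q≡α)) (prev-suc (<-≤-trans (≤-reflexive 1+q≡α) α≤m)))

    πb-last : ∀ {q} → suc q ≡ m → πb ≡ τ W′ q
    πb-last 1+q≡m = cong (τ W′) (prev-zero 1+q≡m)

    Π : ℕ → ℕ
    Π p = if does (p <? α) then p
          else if does (p ≤? m) ∧ not (does (p ≟ α)) then pred p
          else if does (p ≟ b₂) then πb else πa

    Π-E : ∀ {q} → q < m → Π (E q) ≡ q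
    Π-E {q} q<m with q <? α
    ... | yes q<α rewrite punchIn-< q<α | dec-true (q <? α) q<α = refl
    ... | no q≮α rewrite punchIn-≥ (≮⇒≥ q≮α) | dec-false (suc q <? α) (q≮α ∘ <-trans (n<1+n q))
                       | dec-true (suc q ≤? m) q<m | dec-false (suc q ≟ α) (λ eq → q≮α (≤-reflexive eq)) = refl

    Π-beyond : ∀ {p} → m < p → Π p ≡ (if does (p ≟ b₂) then πb else πa)
    Π-beyond {p} m<p rewrite dec-false (p <? α) (λ p<α → <-asym p<α (≤-<-trans α≤m m<p))
                           | dec-false (p ≤? m) (<⇒≱ m<p) = refl

    Π-a₁ : Π a₁ ≡ πa
    Π-a₁ rewrite dec-false (α <? α) (n≮n α) | dec-true (α ≤? m) α≤m | dec-true (α ≟ α) refl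
               | dec-false (α ≟ b₂) (<⇒≢ (≤-<-trans α≤m (<-trans (n<1+n m) (<-trans (n<1+n b₁) (n<1+n a₂))))) = refl

    Π-b₁ : Π b₁ ≡ πa
    Π-b₁ rewrite Π-beyond (n<1+n m) | dec-false (b₁ ≟ b₂) (<⇒≢ (<-trans (n<1+n b₁) (n<1+n a₂))) = refl

    Π-a₂ : Π a₂ ≡ πa
    Π-a₂ rewrite Π-beyond (<-trans (n<1+n m) (n<1+n b₁)) | dec-false (a₂ ≟ b₂) (<⇒≢ (n<1+n a₂)) = refl

    Π-b₂ : Π b₂ ≡ πb
    Π-b₂ rewrite Π-beyond (<-trans (n<1+n m) (<-trans (n<1+n b₁) (n<1+n a₂))) | dec-true (b₂ ≟ b₂) refl = refl

    step : ∀ {p y} → p < length W → τ W p ≡ y → EqClosure (FaceEdge W) p y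
    step p<W τp≡y = fwd (p<W , τp≡y) ◅ ε

    a₂⇝a₁ : EqClosure (FaceEdge W) a₂ a₁
    a₂⇝a₁ = step a₂<W τ-a₂ ◅◅ step b₁<W τ-b₁

    module _ (0<m : 0 < m) (inv′ : PartnerInvolutive W′) where

      πa-inner : α < m → πa ≡ partner W′ α
      πa-inner α<m = cong (partner W′) (next-prev α<m)

      πa-last : α ≡ m → πa ≡ partner W′ 0
      πa-last α≡m = cong (partner W′) (trans (cong (next m ∘ prev m) α≡m) (next-prev-last 0<m))

      πb-inner : πb ≡ partner W′ 0
      πb-inner = cong (partner W′) (next-prev 0<m)

      πa≡πb-last : α ≡ m → πa ≡ πb
      πa≡πb-last α≡m = trans (πa-last α≡m) (sym πb-inner)

      τ′<m : ∀ q → τ W′ q < m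
      τ′<m q = proj₁ (inv′ (next< q 0<m))

      a₁⇝ : EqClosure (FaceEdge W) a₁ (E πa)
      a₁⇝ with m≤n⇒m<n∨m≡n α≤m
      ... | inj₁ α<m = step a₁<W (trans (τ-a₁-inner α<m) (cong E (sym (πa-inner α<m))))
      ... | inj₂ α≡m =
        step a₁<W (τ-a₁-last α≡m) ◅◅
        step b₂<W (trans (τ-b₂-inner (subst (0 <_) (sym α≡m) 0<m)) (cong E (sym (πa-last α≡m))))

      b₂⇝ : EqClosure (FaceEdge W) b₂ (E πb)
      b₂⇝ with α ≟ 0
      ... | yes α≡0 = step b₂<W (τ-b₂-first α≡0) ◅◅ a₂⇝a₁ ◅◅
                      subst (EqClosure (FaceEdge W) a₁ ∘ E) (πa≡πb α≡0) a₁⇝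
      ... | no α≢0  = step b₂<W (trans (τ-b₂-inner (n≢0⇒n>0 α≢0)) (cong E (sym πb-inner)))

      E-edge : ∀ {q y} → FaceEdge W′ q y → EqClosure (FaceEdge W) (E q) (E y)
      E-edge {q} (q<m , refl) with successor q<m
      ... | before-a₁ 1+q≡α = step (E<W q<m) (τ-E-before-a₁ 1+q≡α) ◅◅ a₂⇝a₁ ◅◅
                              subst (EqClosure (FaceEdge W) a₁ ∘ E) (πa-before-a₁ 1+q≡α) a₁⇝
      ... | last 1+q≡m α≤q = step (E<W q<m) (τ-E-last 1+q≡m α≤q) ◅◅
                             subst (EqClosure (FaceEdge W) b₂ ∘ E) (πb-last 1+q≡m) b₂⇝
      ... | regular 1+q<m 1+q≢α = step (E<W q<m) (τ-E-regular 1+q<m 1+q≢α)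

      E-onto : ∀ {p} → p < length W → ∃[ q ] q < m × EqClosure (FaceEdge W) p (E q)
      E-onto p<W with classify p<W
      ... | inner {q} q<m = q , q<m , ε
      ... | at-a₁ = πa , τ′<m _ , a₁⇝
      ... | at-b₁ = πa , τ′<m _ , step b₁<W τ-b₁ ◅◅ a₁⇝
      ... | at-a₂ = πa , τ′<m _ , a₂⇝a₁ ◅◅ a₁⇝
      ... | at-b₂ = πb , τ′<m _ , b₂⇝

      τ′-step : ∀ {q} → q < m → EqClosure (FaceEdge W′) q (τ W′ q)
      τ′-step q<m = fwd (q<m , refl) ◅ ε

      Π-edge : ∀ {p y} → FaceEdge W p y → EqClosure (FaceEdge W′) (Π p) (Π y)
      Π-edge (p<W , refl) with classify p<W
      ... | inner {q} q<m with successor q<m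
      ...   | before-a₁ 1+q≡α
        rewrite τ-E-before-a₁ 1+q≡α | Π-E q<m | Π-a₂ | πa-before-a₁ 1+q≡α = τ′-step q<m
      ...   | last 1+q≡m α≤q
        rewrite τ-E-last 1+q≡m α≤q | Π-E q<m | Π-b₂ | πb-last 1+q≡m = τ′-step q<m
      ...   | regular 1+q<m 1+q≢α
        rewrite τ-E-regular 1+q<m 1+q≢α | Π-E q<m | Π-E (τ′<m q) = τ′-step q<m
      Π-edge (p<W , refl) | at-a₁ with m≤n⇒m<n∨m≡n α≤m
      ... | inj₁ α<m rewrite τ-a₁-inner α<m | Π-a₁ | Π-E (proj₁ (inv′ α<m)) =
        ≡⇒EqClosure (πa-inner α<m)
      ... | inj₂ α≡m rewrite τ-a₁-last α≡m | Π-a₁ | Π-b₂ = ≡⇒EqClosure (πa≡πb-last α≡m)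
      Π-edge (p<W , refl) | at-b₁ rewrite τ-b₁ | Π-b₁ | Π-a₁ = ε
      Π-edge (p<W , refl) | at-a₂ rewrite τ-a₂ | Π-a₂ | Π-b₁ = ε
      Π-edge (p<W , refl) | at-b₂ with α ≟ 0
      ... | yes α≡0 rewrite τ-b₂-first α≡0 | Π-b₂ | Π-a₂ = ≡⇒EqClosure (sym (πa≡πb α≡0))
      ... | no α≢0  rewrite τ-b₂-inner (n≢0⇒n>0 α≢0) | Π-b₂ | Π-E (proj₁ (inv′ 0<m)) =
        ≡⇒EqClosure πb-inner

      Π-onto : ∀ {q} → q < m → ∃[ p ] p < length W × EqClosure (FaceEdge W′) q (Π p)
      Π-onto q<m = E _ , E<W q<m , ≡⇒EqClosure (sym (Π-E q<m))

    W′-empty⇒W-faceConnected : m ≡ 0 → FaceConnected W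
    W′-empty⇒W-faceConnected m≡0 p<W = reach (classify p<W) ◅◅ ≡⇒EqClosure α≡0
      where
        α≡0 = n≤0⇒n≡0 (subst (α ≤_) m≡0 α≤m)
        reach : ∀ {p} → Position p → EqClosure (FaceEdge W) p a₁
        reach (inner {q} q<m) = ⊥-elim (n≮0 (subst (q <_) m≡0 q<m))
        reach at-a₁ = ε
        reach at-b₁ = step b₁<W τ-b₁
        reach at-a₂ = a₂⇝a₁
        reach at-b₂ = step b₂<W (τ-b₂-first α≡0) ◅◅ a₂⇝a₁

  W-faceConnected⇔ : PartnerInvolutive W′ → FaceConnected W ⇔ FaceConnected W′
  W-faceConnected⇔ inv′ with m ≟ 0
  ... | yes m≡0 = mk⇔ (λ _ {q} q<m → ⊥-elim (n≮0 (subst (q <_) m≡0 q<m)))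
                      (λ _ {p} p<W → W′-empty⇒W-faceConnected m≡0 {p} p<W)
  ... | no m≢0  = mk⇔ (connected-onto Π (Π-edge 0<m inv′) (Π-onto 0<m inv′))
                      (connected-onto E (E-edge 0<m inv′) (E-onto 0<m inv′))
    where 0<m = n≢0⇒n>0 m≢0

  W-quasiTree : PartnerInvolutive W′ → isQuasiTree W ≡ isQuasiTree W′
  W-quasiTree inv′ = ⇔→≡ (⇔.trans (quasiTree⇔faceConnected W-orientable (W-involutive inv′))
                         (⇔.trans (W-faceConnected⇔ inv′)
                                  (⇔.sym (quasiTree⇔faceConnected W′-orientable inv′))))

-- The bouquets F′ₙ

occ⁺ : ℕ → Occ
occ⁺ i = i , false

spine : ℕ → SignedRotation
spine k = occ⁺ 1 ∷ occ⁺ 2 ∷ occ⁺ 3 ∷ occ⁺ 2 ∷ occ⁺ 1 ∷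
          concat (map (λ j → occ⁺ (j + 4) ∷ occ⁺ (j + 3) ∷ []) (upTo k))

F′≡spine : ∀ k → F′ (3 + k) ≡ spine k ++ occ⁺ (3 + k) ∷ []
F′≡spine k = refl

spine-suc : ∀ k → spine (suc k) ≡ spine k ++ occ⁺ (4 + k) ∷ occ⁺ (3 + k) ∷ []
spine-suc k = cong (λ t → occ⁺ 1 ∷ occ⁺ 2 ∷ occ⁺ 3 ∷ occ⁺ 2 ∷ occ⁺ 1 ∷ t) (begin
  concat (map f (upTo (suc k)))          ≡⟨ cong (concat ∘ map f) (upTo-∷ʳ k) ⟨
  concat (map f (upTo k ++ k ∷ []))      ≡⟨ cong concat (map-++ f (upTo k) (k ∷ [])) ⟩
  concat (map f (upTo k) ++ f k ∷ [])    ≡⟨ concat-++ (map f (upTo k)) (f k ∷ []) ⟨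
  concat (map f (upTo k)) ++ f k
    ≡⟨ cong₂ (λ i j → concat (map f (upTo k)) ++ occ⁺ i ∷ occ⁺ j ∷ []) (+-comm k 4) (+-comm k 3) ⟩
  concat (map f (upTo k)) ++ occ⁺ (4 + k) ∷ occ⁺ (3 + k) ∷ [] ∎)
  where
    open ≡-Reasoning
    f : ℕ → SignedRotation
    f j = occ⁺ (j + 4) ∷ occ⁺ (j + 3) ∷ []

LabelsAtMost : ℕ → SignedRotation → Set
LabelsAtMost n = All (λ o → proj₁ o ≤ n)

spine-labels : ∀ k → LabelsAtMost (3 + k) (spine k)
spine-labels zero    = s≤s z≤n ∷ s≤s (s≤s z≤n) ∷ ≤-refl ∷ s≤s (s≤s z≤n) ∷ s≤s z≤n ∷ []
spine-labels (suc k) rewrite spine-suc k =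
  Allₚ.++⁺ (All.map m≤n⇒m≤1+n (spine-labels k)) (≤-refl ∷ n≤1+n _ ∷ [])

spine-orientable : ∀ k → Orientable (spine k)
spine-orientable zero    = refl ∷ refl ∷ refl ∷ refl ∷ refl ∷ []
spine-orientable (suc k) rewrite spine-suc k = Allₚ.++⁺ (spine-orientable k) (refl ∷ refl ∷ [])

labelsAtMost⇒fresh : ∀ {n l w} → LabelsAtMost n w → n < l → Fresh l w
labelsAtMost⇒fresh ls n<l = All.map (λ l′≤n l′≡l → <⇒≱ n<l (subst (_≤ _) l′≡l l′≤n)) ls

keep : Bool → Occ → SignedRotation → SignedRotation
keep c o w = if c then o ∷ w else w

module _ {n : ℕ} (F : EdgeSet n) where

  restrict-∷ : ∀ o w → restrict F (o ∷ w) ≡ keep (inF F (proj₁ o)) o (restrict F w)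
  restrict-∷ o w with inF F (proj₁ o)
  ... | true  = refl
  ... | false = refl

  restrict-++ : ∀ u v → restrict F (u ++ v) ≡ restrict F u ++ restrict F v
  restrict-++ = filter-++ _

  restrict-orientable : ∀ {w} → Orientable w → Orientable (restrict F w)
  restrict-orientable = Allₚ.filter⁺ _

  restrict-labels : ∀ {k w} → LabelsAtMost k w → LabelsAtMost k (restrict F w)
  restrict-labels = Allₚ.filter⁺ _

inF-∷ʳ : ∀ {n} (F : EdgeSet n) c {l} → l ≤ n → inF (F ∷ʳ c) l ≡ inF F l
inF-∷ʳ []      c {zero}        _         = refl
inF-∷ʳ (b ∷ F) c {zero}        _         = refl
inF-∷ʳ (b ∷ F) c {suc zero}    _         = refl
inF-∷ʳ (b ∷ F) c {suc (suc l)} (s≤s l≤n) = inF-∷ʳ F c l≤n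

inF-∷ʳ-last : ∀ {n} (F : EdgeSet n) c → inF (F ∷ʳ c) (suc n) ≡ c
inF-∷ʳ-last []      c = refl
inF-∷ʳ-last (b ∷ F) c = inF-∷ʳ-last F c

restrict-∷ʳ : ∀ {n} (F : EdgeSet n) c {w} → LabelsAtMost n w → restrict (F ∷ʳ c) w ≡ restrict F w
restrict-∷ʳ F c {[]}    []        = refl
restrict-∷ʳ F c {o ∷ w} (l≤n ∷ ls)
  rewrite restrict-∷ (F ∷ʳ c) o w | restrict-∷ F o w | inF-∷ʳ F c l≤n | restrict-∷ʳ F c ls = refl

module Split (k : ℕ) where

  K₃ K₄ K₅ : ℕ
  K₃ = 3 + k
  K₄ = 4 + k
  K₅ = 5 + k

  P Q : EdgeSet K₃ → SignedRotation
  P F = restrict F (spine k)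
  Q F = restrict F (occ⁺ K₃ ∷ [])

  private
    open ≡-Reasoning

    F′₅≡ : F′ K₅ ≡ spine (suc k) ++ occ⁺ K₅ ∷ occ⁺ K₄ ∷ occ⁺ K₅ ∷ []
    F′₅≡ = trans (F′≡spine (2 + k))
                 (trans (cong (_++ occ⁺ K₅ ∷ []) (spine-suc (suc k))) (++-assoc (spine (suc k)) _ _))

    F′₅≡′ : F′ K₅ ≡ spine k ++ occ⁺ K₄ ∷ occ⁺ K₃ ∷ occ⁺ K₅ ∷ occ⁺ K₄ ∷ occ⁺ K₅ ∷ []
    F′₅≡′ = trans F′₅≡
                  (trans (cong (_++ occ⁺ K₅ ∷ occ⁺ K₄ ∷ occ⁺ K₅ ∷ []) (spine-suc k)) (++-assoc (spine k) _ _))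

  F′₃≡P++Q : ∀ F → restrict F (F′ K₃) ≡ P F ++ Q F
  F′₃≡P++Q F = trans (cong (restrict F) (F′≡spine k)) (restrict-++ F (spine k) (occ⁺ K₃ ∷ []))

  without-K₅ : ∀ (G : EdgeSet K₄) → restrict (G ∷ʳ false) (F′ K₅) ≡ restrict G (F′ K₄)
  without-K₅ G = begin
    restrict (G ∷ʳ false) (F′ K₅)
      ≡⟨ cong (restrict (G ∷ʳ false)) F′₅≡ ⟩
    restrict (G ∷ʳ false) (spine (suc k) ++ suffix)
      ≡⟨ restrict-++ (G ∷ʳ false) (spine (suc k)) suffix ⟩
    restrict (G ∷ʳ false) (spine (suc k)) ++ restrict (G ∷ʳ false) suffix
      ≡⟨ cong₂ _++_ (restrict-∷ʳ G false (spine-labels (suc k))) tail ⟩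
    restrict G (spine (suc k)) ++ restrict G (occ⁺ K₄ ∷ [])
      ≡⟨ restrict-++ G (spine (suc k)) (occ⁺ K₄ ∷ []) ⟨
    restrict G (spine (suc k) ++ occ⁺ K₄ ∷ [])
      ≡⟨ cong (restrict G) (F′≡spine (suc k)) ⟨
    restrict G (F′ K₄)
      ∎
    where
      suffix = occ⁺ K₅ ∷ occ⁺ K₄ ∷ occ⁺ K₅ ∷ []
      tail : restrict (G ∷ʳ false) suffix ≡ restrict G (occ⁺ K₄ ∷ [])
      tail rewrite restrict-∷ (G ∷ʳ false) (occ⁺ K₅) (occ⁺ K₄ ∷ occ⁺ K₅ ∷ [])
                 | restrict-∷ (G ∷ʳ false) (occ⁺ K₄) (occ⁺ K₅ ∷ [])
                 | restrict-∷ (G ∷ʳ false) (occ⁺ K₅) []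
                 | inF-∷ʳ-last G false | inF-∷ʳ G false {K₄} ≤-refl
                 | restrict-∷ G (occ⁺ K₄) [] = refl

  with-K₅ : ∀ (F : EdgeSet K₃) d → restrict ((F ∷ʳ d) ∷ʳ true) (F′ K₅) ≡
            P F ++ keep d (occ⁺ K₄) (Q F ++ occ⁺ K₅ ∷ keep d (occ⁺ K₄) (occ⁺ K₅ ∷ []))
  with-K₅ F d = begin
    restrict X (F′ K₅)                          ≡⟨ cong (restrict X) F′₅≡′ ⟩
    restrict X (spine k ++ suffix)              ≡⟨ restrict-++ X (spine k) suffix ⟩
    restrict X (spine k) ++ restrict X suffix   ≡⟨ cong₂ _++_ prefix tail ⟩
    P F ++ keep d (occ⁺ K₄) (Q F ++ occ⁺ K₅ ∷ keep d (occ⁺ K₄) (occ⁺ K₅ ∷ [])) ∎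
    where
      X = (F ∷ʳ d) ∷ʳ true
      suffix = occ⁺ K₄ ∷ occ⁺ K₃ ∷ occ⁺ K₅ ∷ occ⁺ K₄ ∷ occ⁺ K₅ ∷ []
      prefix : restrict X (spine k) ≡ P F
      prefix = trans (restrict-∷ʳ (F ∷ʳ d) true (All.map m≤n⇒m≤1+n (spine-labels k)))
                     (restrict-∷ʳ F d (spine-labels k))
      tail : restrict X suffix ≡ keep d (occ⁺ K₄) (Q F ++ occ⁺ K₅ ∷ keep d (occ⁺ K₄) (occ⁺ K₅ ∷ []))
      tail rewrite restrict-∷ X (occ⁺ K₄) (occ⁺ K₃ ∷ occ⁺ K₅ ∷ occ⁺ K₄ ∷ occ⁺ K₅ ∷ [])
                 | restrict-∷ X (occ⁺ K₃) (occ⁺ K₅ ∷ occ⁺ K₄ ∷ occ⁺ K₅ ∷ [])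
                 | restrict-∷ X (occ⁺ K₅) (occ⁺ K₄ ∷ occ⁺ K₅ ∷ [])
                 | restrict-∷ X (occ⁺ K₄) (occ⁺ K₅ ∷ [])
                 | restrict-∷ X (occ⁺ K₅) []
                 | restrict-∷ F (occ⁺ K₃) []
                 | inF-∷ʳ-last (F ∷ʳ d) true
                 | inF-∷ʳ (F ∷ʳ d) true {K₄} ≤-refl | inF-∷ʳ-last F d
                 | inF-∷ʳ (F ∷ʳ d) true {K₃} (n≤1+n K₃) | inF-∷ʳ F d {K₃} ≤-refl
                 with inF F K₃
      ... | true  = refl
      ... | false = refl

  adjacent-K₅ : ∀ F →
    restrict ((F ∷ʳ false) ∷ʳ true) (F′ K₅) ≡ restrict F (F′ K₃) ++ occ⁺ K₅ ∷ occ⁺ K₅ ∷ []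
  adjacent-K₅ F = begin
    restrict ((F ∷ʳ false) ∷ʳ true) (F′ K₅)     ≡⟨ with-K₅ F false ⟩
    P F ++ Q F ++ occ⁺ K₅ ∷ occ⁺ K₅ ∷ []       ≡⟨ ++-assoc (P F) (Q F) _ ⟨
    (P F ++ Q F) ++ occ⁺ K₅ ∷ occ⁺ K₅ ∷ []     ≡⟨ cong (_++ occ⁺ K₅ ∷ occ⁺ K₅ ∷ []) (F′₃≡P++Q F) ⟨
    restrict F (F′ K₃) ++ occ⁺ K₅ ∷ occ⁺ K₅ ∷ [] ∎

  interlaced-K₅ : ∀ F →
    restrict ((F ∷ʳ true) ∷ʳ true) (F′ K₅) ≡ P F ++ occ⁺ K₄ ∷ (Q F ++ occ⁺ K₅ ∷ occ⁺ K₄ ∷ occ⁺ K₅ ∷ [])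
  interlaced-K₅ F = with-K₅ F true

count-allEdgeSets-head : ∀ n (P : EdgeSet (suc n) → Bool) →
  count P (allEdgeSets (suc n)) ≡ count (P ∘ (false ∷_)) (allEdgeSets n) + count (P ∘ (true ∷_)) (allEdgeSets n)
count-allEdgeSets-head n P = trans (count-++ P (map (false ∷_) Fs) (map (true ∷_) Fs))
                                   (cong₂ _+_ (count-map P (false ∷_) Fs) (count-map P (true ∷_) Fs))
  where Fs = allEdgeSets n

count-allEdgeSets-last : ∀ n (P : EdgeSet (suc n) → Bool) →
  count P (allEdgeSets (suc n)) ≡ count (P ∘ (_∷ʳ false)) (allEdgeSets n) + count (P ∘ (_∷ʳ true)) (allEdgeSets n)
count-allEdgeSets-last zero    P = count-allEdgeSets-head zero P
count-allEdgeSets-last (suc n) P = begin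
  count P (allEdgeSets (2 + n))
    ≡⟨ count-allEdgeSets-head (suc n) P ⟩
  count (P ∘ (false ∷_)) (allEdgeSets (suc n)) + count (P ∘ (true ∷_)) (allEdgeSets (suc n))
    ≡⟨ cong₂ _+_ (count-allEdgeSets-last n (P ∘ (false ∷_))) (count-allEdgeSets-last n (P ∘ (true ∷_))) ⟩
  (c false false + c false true) + (c true false + c true true)
    ≡⟨ interchange (c false false) (c false true) (c true false) (c true true) ⟩
  (c false false + c true false) + (c false true + c true true)
    ≡⟨ cong₂ _+_ (count-allEdgeSets-head n (P ∘ (_∷ʳ false))) (count-allEdgeSets-head n (P ∘ (_∷ʳ true))) ⟨
  count (P ∘ (_∷ʳ false)) (allEdgeSets (suc n)) + count (P ∘ (_∷ʳ true)) (allEdgeSets (suc n)) ∎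
  where
    open ≡-Reasoning
    c : Bool → Bool → ℕ
    c b d = count (λ F → P (b ∷ (F ∷ʳ d))) (allEdgeSets n)

∈-allEdgeSets : ∀ {n} (F : EdgeSet n) → F ∈ allEdgeSets n
∈-allEdgeSets []          = here refl
∈-allEdgeSets (false ∷ F) = ∈-++⁺ˡ (∈-map⁺ (false ∷_) (∈-allEdgeSets F))
∈-allEdgeSets (true ∷ F)  = ∈-++⁺ʳ _ (∈-map⁺ (true ∷_) (∈-allEdgeSets F))

partnerInvolutive? : ∀ w → Dec (PartnerInvolutive w)
partnerInvolutive? w = allUpTo? (λ p → (partner w p <? length w) ×-dec (partner w (partner w p) ≟ p)) (length w)

RestrictionsInvolutive : ℕ → Set
RestrictionsInvolutive n = ∀ (F : EdgeSet n) → PartnerInvolutive (restrict F (F′ n))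

restrictionsInvolutive-by-computation : ∀ n →
  True (All.all? (λ F → partnerInvolutive? (restrict F (F′ n))) (allEdgeSets n)) → RestrictionsInvolutive n
restrictionsInvolutive-by-computation n ok F = All.lookup (toWitness ok) (∈-allEdgeSets F)

module Recurrence (k : ℕ) where
  open Split k

  private
    F′₃-labels : LabelsAtMost K₃ (F′ K₃)
    F′₃-labels = Allₚ.++⁺ (spine-labels k) (≤-refl ∷ [])

    F′₃-orientable : Orientable (F′ K₃)
    F′₃-orientable = Allₚ.++⁺ (spine-orientable k) (refl ∷ [])

    K₃<K₄ : K₃ < K₄
    K₃<K₄ = n<1+n K₃

    K₃<K₅ : K₃ < K₅
    K₃<K₅ = m<n⇒m<1+n K₃<K₄

    P-labels : ∀ F → LabelsAtMost K₃ (P F)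
    P-labels F = restrict-labels F (spine-labels k)

    Q-labels : ∀ F → LabelsAtMost K₃ (Q F)
    Q-labels F = restrict-labels F (≤-refl ∷ [])

    module Adjacent (F : EdgeSet K₃) =
      AdjacentPair (labelsAtMost⇒fresh (restrict-labels F F′₃-labels) K₃<K₅)
                   (restrict-orientable F F′₃-orientable)

    module Interlaced (F : EdgeSet K₃) =
      InterlacedPairs {P F} {Q F} (<⇒≢ (n<1+n K₄))
        (labelsAtMost⇒fresh (P-labels F) K₃<K₄) (labelsAtMost⇒fresh (Q-labels F) K₃<K₄)
        (labelsAtMost⇒fresh (P-labels F) K₃<K₅) (labelsAtMost⇒fresh (Q-labels F) K₃<K₅)
        (restrict-orientable F (spine-orientable k)) (restrict-orientable F (refl ∷ []))

  restrictionsInvolutive-step : RestrictionsInvolutive K₃ → RestrictionsInvolutive K₄ → RestrictionsInvolutive K₅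
  restrictionsInvolutive-step inv₃ inv₄ H with initLast H
  ... | G , false , refl = subst PartnerInvolutive (sym (without-K₅ G)) (inv₄ G)
  ... | G , true  , refl with initLast G
  ...   | F , false , refl = subst PartnerInvolutive (sym (adjacent-K₅ F)) (Adjacent.W-involutive F (inv₃ F))
  ...   | F , true  , refl = subst PartnerInvolutive (sym (interlaced-K₅ F))
                               (Interlaced.W-involutive F (subst PartnerInvolutive (F′₃≡P++Q F) (inv₃ F)))

  κ-recurrence : RestrictionsInvolutive K₃ → κ K₅ (F′ K₅) ≡ κ K₄ (F′ K₄) + κ K₃ (F′ K₃)
  κ-recurrence inv₃ = begin
    κ K₅ (F′ K₅)
      ≡⟨ κ≡count K₅ (F′ K₅) ⟩
    count qt₅ (allEdgeSets K₅)
      ≡⟨ count-allEdgeSets-last K₄ qt₅ ⟩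
    count (qt₅ ∘ (_∷ʳ false)) (allEdgeSets K₄) + count (qt₅ ∘ (_∷ʳ true)) (allEdgeSets K₄)
      ≡⟨ cong₂ _+_ without (count-allEdgeSets-last K₃ (qt₅ ∘ (_∷ʳ true))) ⟩
    κ K₄ (F′ K₄) + (count (λ F → qt₅ ((F ∷ʳ false) ∷ʳ true)) (allEdgeSets K₃) +
                    count (λ F → qt₅ ((F ∷ʳ true) ∷ʳ true)) (allEdgeSets K₃))
      ≡⟨ cong (κ K₄ (F′ K₄) +_) (cong₂ _+_ adjacent interlaced) ⟩
    κ K₄ (F′ K₄) + κ K₃ (F′ K₃)
      ∎
    where
      open ≡-Reasoning
      qt₅ : EdgeSet K₅ → Bool
      qt₅ H = isQuasiTree (restrict H (F′ K₅))

      without : count (qt₅ ∘ (_∷ʳ false)) (allEdgeSets K₄) ≡ κ K₄ (F′ K₄)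
      without = trans (count-cong (cong isQuasiTree ∘ without-K₅) (allEdgeSets K₄))
                      (sym (κ≡count K₄ (F′ K₄)))

      adjacent : count (λ F → qt₅ ((F ∷ʳ false) ∷ʳ true)) (allEdgeSets K₃) ≡ 0
      adjacent = count≡0⇐ _ {allEdgeSets K₃} λ {F} _ →
        trans (cong isQuasiTree (adjacent-K₅ F)) (Adjacent.W-not-quasiTree F (inv₃ F))

      interlaced : count (λ F → qt₅ ((F ∷ʳ true) ∷ʳ true)) (allEdgeSets K₃) ≡ κ K₃ (F′ K₃)
      interlaced = trans (count-cong qt₅≡qt₃ (allEdgeSets K₃)) (sym (κ≡count K₃ (F′ K₃)))
        where
          qt₅≡qt₃ : ∀ F → qt₅ ((F ∷ʳ true) ∷ʳ true) ≡ isQuasiTree (restrict F (F′ K₃))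
          qt₅≡qt₃ F = begin
            qt₅ ((F ∷ʳ true) ∷ʳ true)
              ≡⟨ cong isQuasiTree (interlaced-K₅ F) ⟩
            isQuasiTree (Interlaced.W F)
              ≡⟨ Interlaced.W-quasiTree F (subst PartnerInvolutive (F′₃≡P++Q F) (inv₃ F)) ⟩
            isQuasiTree (P F ++ Q F)
              ≡⟨ cong isQuasiTree (F′₃≡P++Q F) ⟨
            isQuasiTree (restrict F (F′ K₃))
              ∎

restrictionsInvolutive : ∀ k → RestrictionsInvolutive (3 + k) × RestrictionsInvolutive (4 + k)
restrictionsInvolutive zero    =
  restrictionsInvolutive-by-computation 3 _ , restrictionsInvolutive-by-computation 4 _
restrictionsInvolutive (suc k) with inv₃ , inv₄ ← restrictionsInvolutive k =
  inv₄ , Recurrence.restrictionsInvolutive-step k inv₃ inv₄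

κ-lucas : ∀ k → κ (3 + k) (F′ (3 + k)) ≡ lucas (2 + k) × κ (4 + k) (F′ (4 + k)) ≡ lucas (3 + k)
κ-lucas zero    = refl , refl
κ-lucas (suc k) with κ₃ , κ₄ ← κ-lucas k =
  κ₄ , trans (Recurrence.κ-recurrence k (proj₁ (restrictionsInvolutive k))) (cong₂ _+_ κ₄ κ₃)

theorem5p1 : (n : ℕ) → 2 ≤ n → κ n (F′ n) ≡ lucas (n ∸ 1)
theorem5p1 (suc zero)          (s≤s ())
theorem5p1 (suc (suc zero))    _ = refl
theorem5p1 (suc (suc (suc k))) _ = proj₁ (κ-lucas k)
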